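{- Let $G$ be a graph with $n$ vertices. Then for every $k$, \[[x^k]\tau_G=(-1)^{n+k}\sum_{m=1}^{k}\binom{n-m}{k-m}[x^m]\chi_G,\] where $\chi_G$ is the chromatic polynomial of $G$.
   Context: All graphs are finite and simple. The chromatic symmetric function of $G$ is $X_G=\sum_\kappa\prod_{v\in V(G)}x_{\kappa(v)}$, the sum over proper colourings $\kappa:V(G)\to\mathbb{Z}_{>0}$, an element of the algebra $\Lambda$ of symmetric functions over $\mathbb{Q}$. For a partition $\lambda=(\lambda_1,\dots,\lambda_\ell)$, $\ell(\lambda)=\ell$ is its number of parts; $P_n$ is the path on $n$ vertices and $P_\lambda$ the disjoint union $P_{\lambda_1}\cup\dots\cup P_{\lambda_\ell}$. The $X_{P_\lambda}$ (over all partitions) form a basis of $\Lambda$. The tree polynomial of $f=\sum_\lambda a_\lambda X_{P_\lambda}\in\Lambda$ is $\tau_f(x)=\sum_\lambda a_\lambda x^{\ell(\lambda)}$, and $\tau_G:=\tau_{X_G}$. -}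

module Defs where

open import Data.Nat as ℕ using (ℕ; zero; suc; _≡ᵇ_)
open import Data.Nat.Combinatorics using (_C_)
open import Data.Fin as Fin using (Fin; toℕ)
open import Data.List using (List; []; _∷_; map; concatMap; foldr; length; allFin)
open import Data.Nat.ListAction using (sum)
open import Data.Bool.ListAction using (all; any)
open import Data.List.Relation.Unary.All using (All)
open import Data.List.Relation.Unary.Linked using (Linked)
open import Data.Bool using (Bool; true; false; not; _∧_; _∨_; if_then_else_)
open import Data.Vec.Functional using () renaming (_∷_ to _◂_)
open import Data.Product using (Σ; _×_; _,_; proj₁; proj₂)
open import Data.Integer using (+_)
open import Data.Rational using (ℚ; 0ℚ; 1ℚ; _+_; _*_; -_; _/_)
open import Relation.Nullary.Decidable using (⌊_⌋)
open import Relation.Binary.PropositionalEquality using (_≡_; _≢_)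

record SimpleGraph (n : ℕ) : Set where
  field
    adj    : Fin n → Fin n → Bool
    sym    : ∀ i j → adj i j ≡ adj j i
    irrefl : ∀ i → adj i i ≡ false
open SimpleGraph public

ℕ→ℚ : ℕ → ℚ
ℕ→ℚ n = + n / 1

sumℚ : List ℚ → ℚ
sumℚ = foldr _+_ 0ℚ

allFuns : (n N : ℕ) → List (Fin n → Fin N)
allFuns zero    N = (λ ()) ∷ []
allFuns (suc n) N = concatMap (λ c → map (λ f → c ◂ f) (allFuns n N)) (allFin N)

countB : List Bool → ℕ
countB bs = sum (map (λ b → if b then 1 else 0) bs)

proper : {n N : ℕ} → (Fin n → Fin n → Bool) → (Fin n → Fin N) → Bool
proper {n} a κ = all (λ i → all (λ j → not (a i j) ∨ not ⌊ κ i Fin.≟ κ j ⌋) (allFin n)) (allFin n)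

colourCount : {n N : ℕ} → (Fin n → Fin N) → Fin N → ℕ
colourCount {n} κ c = countB (map (λ i → ⌊ κ i Fin.≟ c ⌋) (allFin n))

-- coefficient of the monomial x_1^{e_1} ... x_N^{e_N} in X (restricted to
-- variables x_1..x_N, which does not change coefficients of such monomials)
xCoeff : {n : ℕ} → (Fin n → Fin n → Bool) → (N : ℕ) → (Fin N → ℕ) → ℕ
xCoeff {n} a N e =
  countB (map (λ κ → proper a κ ∧ all (λ c → colourCount κ c ≡ᵇ e c) (allFin N)) (allFuns n N))

numColourings : {n : ℕ} → (Fin n → Fin n → Bool) → ℕ → ℕ
numColourings {n} a N = countB (map (proper a) (allFuns n N))

IsPartition : List ℕ → Set
IsPartition λs = All (λ p → 0 ℕ.< p) λs × Linked ℕ._≥_ λs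

Partition : Set
Partition = Σ (List ℕ) IsPartition

-- partial sums λ1, λ1+λ2, ... : the first vertices of the later blocks
cuts : List ℕ → List ℕ
cuts []       = []
cuts (a ∷ as) = a ∷ map (a ℕ.+_) (cuts as)

-- adjacency of P_λ = P_{λ1} ∪ ... ∪ P_{λℓ}, vertices 0..|λ|-1 laid out block by block
pathAdj : (λs : List ℕ) → Fin (sum λs) → Fin (sum λs) → Bool
pathAdj λs i j = step i j ∨ step j i
  where
  step : Fin (sum λs) → Fin (sum λs) → Bool
  step u v = (suc (toℕ u) ≡ᵇ toℕ v) ∧ not (any (λ t → t ≡ᵇ toℕ v) (cuts λs))

-- A finite formal combination Σ q_λ X_{P_λ}
Combination : Set
Combination = List (Partition × ℚ)

-- f = Σ q_λ X_{P_λ} equals X_G (coefficientwise, every monomial in finitely many variables)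
IsPathExpansionOf : {n : ℕ} → SimpleGraph n → Combination → Set
IsPathExpansionOf G L =
  ∀ (N : ℕ) (e : Fin N → ℕ) →
    ℕ→ℚ (xCoeff (adj G) N e)
      ≡ sumℚ (map (λ t → proj₂ t * ℕ→ℚ (xCoeff (pathAdj (proj₁ (proj₁ t))) N e)) L)

-- [x^k] τ, where τ = Σ q_λ x^{ℓ(λ)}
treeCoeff : Combination → ℕ → ℚ
treeCoeff L k = sumℚ (map (λ t → if length (proj₁ (proj₁ t)) ≡ᵇ k then proj₂ t else 0ℚ) L)

-- polynomials as coefficient lists (index m = coefficient of x^m)
coeff : List ℚ → ℕ → ℚ
coeff []       _       = 0ℚ
coeff (c ∷ cs) zero    = c
coeff (c ∷ cs) (suc m) = coeff cs m

evalPoly : List ℚ → ℚ → ℚ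
evalPoly []       x = 0ℚ
evalPoly (c ∷ cs) x = c + x * evalPoly cs x

IsChromaticPoly : {n : ℕ} → SimpleGraph n → List ℚ → Set
IsChromaticPoly G c = ∀ (N : ℕ) → evalPoly c (ℕ→ℚ N) ≡ ℕ→ℚ (numColourings (adj G) N)

signℚ : ℕ → ℚ
signℚ zero    = 1ℚ
signℚ (suc m) = - signℚ m

sumFrom1 : ℕ → (ℕ → ℚ) → ℚ
sumFrom1 zero    f = 0ℚ
sumFrom1 (suc k) f = sumFrom1 k f + f (suc k)

rhs : ℕ → List ℚ → ℕ → ℚ
rhs n c k = signℚ (n ℕ.+ k) * sumFrom1 k (λ m → ℕ→ℚ ((n ℕ.∸ m) C (k ℕ.∸ m)) * coeff c m)

module Submission where

-- Both X_G and every X_{P_λ} are sums over proper colourings, so adding up the coefficients of all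
-- monomials of degree d in N variables turns X_G = Σ q_λ X_{P_λ} into [n = d] χ_G(N) = Σ_{|λ| = d} q_λ χ_{P_λ}(N).
-- This holds for every N, so it is an identity of polynomials for each d. Now χ_{P_λ} = Π x (x - 1)^(λᵢ - 1),
-- and the transform p ↦ Σₘ pₘ xᵐ (x - 1)^(d - m) with d = |λ| sends it to x^ℓ(λ). Transforming the slice of
-- size d with its own d and summing over d gives τ_G = Σₘ [xᵐ]χ_G · xᵐ (x - 1)^(n - m); expanding (x - 1)^(n - m)
-- binomially and using [x⁰]χ_G = 0 yields the formula.

open import Defs hiding (sym)
open import Level using (0ℓ)
open import Algebra.Bundles using (CommutativeSemiring; CommutativeRing)
open import Data.Bool.Base using (Bool; true; false; not; _∧_; _∨_; if_then_else_)
open import Data.Bool.ListAction using (all; and; any; or)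
open import Data.Nat.Base as ℕ using (ℕ; zero; suc; _∸_; _≤_; z≤n; s≤s)
open import Data.Product.Base using (_×_; _,_; proj₁; proj₂)
import Data.Nat.Properties as ℕ
import Data.Nat.Coprimality as Coprime
import Data.Integer.Base as ℤ
import Data.Integer.Properties as ℤ
open import Data.Rational.Base using (ℚ)
import Data.Rational.Properties as ℚ
open import Data.Fin.Base as Fin using (Fin; zero; suc; toℕ)
open import Data.Fin.Properties using (_≟_)
open import Data.List.Base using (List; []; _∷_; _++_; map; concatMap; foldr; length; allFin)
open import Data.List.Properties using (length-map; map-∘; map-id; map-cong; map-tabulate; length-tabulate)
open import Data.List.Relation.Unary.All as All using (All; []; _∷_)
open import Data.List.Relation.Unary.All.Properties using (all⁺)
open import Data.List.Membership.Propositional.Properties using (∈-allFin)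
open import Data.Vec.Functional using () renaming (_∷_ to _◂_)
open import Data.Bool.Properties using (T-≡; ∧-assoc; ∧-idem; ∧-zeroʳ; ∧-identityʳ; ∨-comm)
open import Function.Bundles using (Equivalence)
open import Data.Nat.ListAction using (sum)
open import Function.Base using (_∘_; id)
open import Relation.Nullary.Decidable using (⌊_⌋; yes; no)
open import Relation.Nullary.Negation using (contradiction)
open import Relation.Binary.PropositionalEquality as ≡ using (_≡_)

map-allFin-suc : ∀ {n} {B : Set} (f : Fin (suc n) → B) → map f (allFin (suc n)) ≡ f zero ∷ map (f ∘ suc) (allFin n)
map-allFin-suc {n} f = ≡.cong (f zero ∷_) (≡.trans (map-tabulate suc f) (≡.sym (map-tabulate id (f ∘ suc))))

module ListSum (R : CommutativeSemiring 0ℓ 0ℓ) where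

  open CommutativeSemiring R
    using (Carrier; _≈_; _+_; _*_; 0#; setoid; refl; sym; trans; +-cong; +-congˡ;
           +-identityˡ; +-assoc; *-comm; zeroʳ; distribˡ; +-commutativeSemigroup;
           *-commutativeSemigroup)
  open import Algebra.Properties.CommutativeSemigroup +-commutativeSemigroup using (interchange)
  open import Algebra.Properties.CommutativeSemigroup *-commutativeSemigroup using (x∙yz≈y∙xz)
  open import Relation.Binary.Reasoning.Setoid setoid

  private variable B C : Set

  ∑ : List B → (B → Carrier) → Carrier
  ∑ xs f = foldr _+_ 0# (map f xs)

  syntax ∑ xs (λ x → e) = ∑[ x ∈ xs ] e

  ∑-cong : (xs : List B) {f g : B → Carrier} → (∀ x → f x ≈ g x) → ∑ xs f ≈ ∑ xs g
  ∑-cong []       f≈g = refl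
  ∑-cong (x ∷ xs) f≈g = +-cong (f≈g x) (∑-cong xs f≈g)

  ∑-cong-All : {P : B → Set} (xs : List B) {f g : B → Carrier} →
               All P xs → (∀ x → P x → f x ≈ g x) → ∑ xs f ≈ ∑ xs g
  ∑-cong-All []       []         f≈g = refl
  ∑-cong-All (x ∷ xs) (px ∷ pxs) f≈g = +-cong (f≈g x px) (∑-cong-All xs pxs f≈g)

  ∑-zero : (xs : List B) → ∑[ _ ∈ xs ] 0# ≈ 0#
  ∑-zero []       = refl
  ∑-zero (x ∷ xs) = trans (+-identityˡ _) (∑-zero xs)

  ∑-+ : (xs : List B) (f g : B → Carrier) → ∑[ x ∈ xs ] (f x + g x) ≈ ∑ xs f + ∑ xs g
  ∑-+ []       f g = sym (+-identityˡ 0#)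
  ∑-+ (x ∷ xs) f g = trans (+-congˡ (∑-+ xs f g)) (interchange _ _ _ _)

  ∑-*ˡ : (xs : List B) (a : Carrier) (f : B → Carrier) → ∑[ x ∈ xs ] (a * f x) ≈ a * ∑ xs f
  ∑-*ˡ []       a f = sym (zeroʳ a)
  ∑-*ˡ (x ∷ xs) a f = trans (+-congˡ (∑-*ˡ xs a f)) (sym (distribˡ a _ _))

  ∑-*ʳ : (xs : List B) (a : Carrier) (f : B → Carrier) → ∑[ x ∈ xs ] (f x * a) ≈ ∑ xs f * a
  ∑-*ʳ xs a f = begin
    ∑[ x ∈ xs ] (f x * a) ≈⟨ ∑-cong xs (λ x → *-comm (f x) a) ⟩
    ∑[ x ∈ xs ] (a * f x) ≈⟨ ∑-*ˡ xs a f ⟩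
    a * ∑ xs f            ≈⟨ *-comm a _ ⟩
    ∑ xs f * a            ∎

  ∑-++ : (xs ys : List B) (f : B → Carrier) → ∑ (xs ++ ys) f ≈ ∑ xs f + ∑ ys f
  ∑-++ []       ys f = sym (+-identityˡ _)
  ∑-++ (x ∷ xs) ys f = trans (+-congˡ (∑-++ xs ys f)) (sym (+-assoc _ _ _))

  ∑-comm : (xs : List B) (ys : List C) (f : B → C → Carrier) →
           ∑[ x ∈ xs ] ∑[ y ∈ ys ] f x y ≈ ∑[ y ∈ ys ] ∑[ x ∈ xs ] f x y
  ∑-comm []       ys f = sym (∑-zero ys)
  ∑-comm (x ∷ xs) ys f =
    trans (+-congˡ (∑-comm xs ys f)) (sym (∑-+ ys (f x) (λ y → ∑[ x′ ∈ xs ] f x′ y)))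

  ∑-*-∑-comm : (xs : List B) (ys : List C) (w : B → Carrier) (a : C → Carrier) (f : C → B → Carrier) →
               ∑[ x ∈ xs ] (w x * ∑[ y ∈ ys ] (a y * f y x)) ≈ ∑[ y ∈ ys ] (a y * ∑[ x ∈ xs ] (w x * f y x))
  ∑-*-∑-comm xs ys w a f = begin
    ∑[ x ∈ xs ] (w x * ∑[ y ∈ ys ] (a y * f y x))    ≈⟨ ∑-cong xs (λ x → ∑-*ˡ ys (w x) _) ⟨
    ∑[ x ∈ xs ] ∑[ y ∈ ys ] (w x * (a y * f y x))    ≈⟨ ∑-comm xs ys _ ⟩
    ∑[ y ∈ ys ] ∑[ x ∈ xs ] (w x * (a y * f y x))    ≈⟨ ∑-cong ys (λ y → ∑-cong xs (λ x → x∙yz≈y∙xz (w x) (a y) (f y x))) ⟩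
    ∑[ y ∈ ys ] ∑[ x ∈ xs ] (a y * (w x * f y x))    ≈⟨ ∑-cong ys (λ y → ∑-*ˡ xs (a y) _) ⟩
    ∑[ y ∈ ys ] (a y * ∑[ x ∈ xs ] (w x * f y x))    ∎

  ∑-map : (xs : List B) (h : B → C) (f : C → Carrier) → ∑ (map h xs) f ≡ ∑ xs (f ∘ h)
  ∑-map xs h f = ≡.cong (foldr _+_ 0#) (≡.sym (map-∘ xs))

  ∑-concatMap : (xs : List B) (g : B → List C) (f : C → Carrier) →
                ∑ (concatMap g xs) f ≈ ∑[ x ∈ xs ] ∑ (g x) f
  ∑-concatMap []       g f = refl
  ∑-concatMap (x ∷ xs) g f = trans (∑-++ (g x) (concatMap g xs) f) (+-congˡ (∑-concatMap xs g f))

  ∑-allFin-suc : ∀ {n} (f : Fin (suc n) → Carrier) → ∑ (allFin (suc n)) f ≡ f zero + ∑ (allFin n) (f ∘ suc)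
  ∑-allFin-suc f = ≡.cong (foldr _+_ 0#) (map-allFin-suc f)

module ℕ-Sum = ListSum ℕ.+-*-commutativeSemiring
module ℚ-Sum = ListSum (CommutativeRing.commutativeSemiring ℚ.+-*-commutativeRing)

module Colourings where

  open import Data.Nat.Base using (_+_; _*_; _<_; _≡ᵇ_)
  open ℕ-Sum
  open ≡ using (refl; sym; trans; cong; cong₂)
  open ≡.≡-Reasoning

  private variable B : Set

  𝟙 : Bool → ℕ
  𝟙 b = if b then 1 else 0

  𝟙-∧ : ∀ a b → 𝟙 (a ∧ b) ≡ 𝟙 a * 𝟙 b
  𝟙-∧ false b = refl
  𝟙-∧ true  b = sym (ℕ.+-identityʳ (𝟙 b))

  𝟙-not : ∀ b → 𝟙 (not b) + 𝟙 b ≡ 1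
  𝟙-not false = refl
  𝟙-not true  = refl

  countB-map : (p : B → Bool) (xs : List B) → countB (map p xs) ≡ ∑ xs (𝟙 ∘ p)
  countB-map p xs = ∑-map xs p 𝟙

  ∑-1≡length : (xs : List B) → ∑[ _ ∈ xs ] 1 ≡ length xs
  ∑-1≡length []       = refl
  ∑-1≡length (x ∷ xs) = cong suc (∑-1≡length xs)

  ∑-allFin-1 : ∀ n → ∑[ _ ∈ allFin n ] 1 ≡ n
  ∑-allFin-1 n = trans (∑-1≡length (allFin n)) (length-tabulate id)

  ∑-allFin-const : ∀ n m → ∑[ _ ∈ allFin n ] m ≡ n * m
  ∑-allFin-const n m = begin
    ∑[ _ ∈ allFin n ] m        ≡⟨ ∑-cong (allFin n) (λ _ → ℕ.*-identityʳ m) ⟨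
    ∑[ _ ∈ allFin n ] (m * 1)  ≡⟨ ∑-*ˡ (allFin n) m (λ _ → 1) ⟩
    m * ∑[ _ ∈ allFin n ] 1    ≡⟨ cong (m *_) (∑-allFin-1 n) ⟩
    m * n                      ≡⟨ ℕ.*-comm m n ⟩
    n * m                      ∎

  ≤-∑ : (xs : List B) (f : B → ℕ) → All (λ x → f x ≤ ∑ xs f) xs
  ≤-∑ []       f = []
  ≤-∑ (x ∷ xs) f =
    ℕ.m≤m+n (f x) (∑ xs f) ∷ All.map (λ fy≤ → ℕ.≤-trans fy≤ (ℕ.m≤n+m (∑ xs f) (f x))) (≤-∑ xs f)

  ∑-𝟙≤length : (xs : List B) (p : B → Bool) → ∑ xs (𝟙 ∘ p) ≤ length xs
  ∑-𝟙≤length []       p = z≤n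
  ∑-𝟙≤length (x ∷ xs) p with p x
  ... | true  = s≤s (∑-𝟙≤length xs p)
  ... | false = ℕ.m≤n⇒m≤1+n (∑-𝟙≤length xs p)

  ≟-suc : ∀ {N} (x y : Fin N) → ⌊ Fin.suc x ≟ Fin.suc y ⌋ ≡ ⌊ x ≟ y ⌋
  ≟-suc x y with x ≟ y
  ... | yes _ = refl
  ... | no  _ = refl

  ≟-sym : ∀ {N} (x y : Fin N) → ⌊ x ≟ y ⌋ ≡ ⌊ y ≟ x ⌋
  ≟-sym x y with x ≟ y | y ≟ x
  ... | yes _   | yes _   = refl
  ... | no  _   | no  _   = refl
  ... | yes x≡y | no  y≢x = contradiction (sym x≡y) y≢x
  ... | no  x≢y | yes y≡x = contradiction (sym y≡x) x≢y

  ∑-allFin-𝟙≟ : ∀ {N} (x : Fin N) → ∑[ c ∈ allFin N ] 𝟙 ⌊ x ≟ c ⌋ ≡ 1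
  ∑-allFin-𝟙≟ {suc N} zero = trans (∑-allFin-suc {N} (λ c → 𝟙 ⌊ zero ≟ c ⌋)) (cong suc (∑-zero (allFin N)))
  ∑-allFin-𝟙≟ {suc N} (suc x) = begin
    ∑[ c ∈ allFin (suc N) ] 𝟙 ⌊ suc x ≟ c ⌋  ≡⟨ ∑-allFin-suc {N} (λ c → 𝟙 ⌊ suc x ≟ c ⌋) ⟩
    ∑[ c ∈ allFin N ] 𝟙 ⌊ suc x ≟ suc c ⌋    ≡⟨ ∑-cong (allFin N) (λ c → cong 𝟙 (≟-suc x c)) ⟩
    ∑[ c ∈ allFin N ] 𝟙 ⌊ x ≟ c ⌋            ≡⟨ ∑-allFin-𝟙≟ x ⟩
    1                                        ∎

  ∑-allFin-𝟙≢ : ∀ {N} (x : Fin N) → ∑[ c ∈ allFin N ] 𝟙 (not ⌊ c ≟ x ⌋) ≡ N ∸ 1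
  ∑-allFin-𝟙≢ {N} x = begin
    others          ≡⟨ ℕ.m+n∸n≡m others 1 ⟨
    others + 1 ∸ 1  ≡⟨ cong (_∸ 1) others+1≡N ⟩
    N ∸ 1           ∎
    where
    others : ℕ
    others = ∑[ c ∈ allFin N ] 𝟙 (not ⌊ c ≟ x ⌋)
    hit : ∑[ c ∈ allFin N ] 𝟙 ⌊ c ≟ x ⌋ ≡ 1
    hit = trans (∑-cong (allFin N) (λ c → cong 𝟙 (≟-sym c x))) (∑-allFin-𝟙≟ x)
    others+1≡N : others + 1 ≡ N
    others+1≡N = begin
      others + 1                                           ≡⟨ cong (others +_) hit ⟨
      others + ∑[ c ∈ allFin N ] 𝟙 ⌊ c ≟ x ⌋               ≡⟨ ∑-+ (allFin N) _ _ ⟨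
      ∑[ c ∈ allFin N ] (𝟙 (not ⌊ c ≟ x ⌋) + 𝟙 ⌊ c ≟ x ⌋)  ≡⟨ ∑-cong (allFin N) (λ c → 𝟙-not ⌊ c ≟ x ⌋) ⟩
      ∑[ _ ∈ allFin N ] 1                                  ≡⟨ ∑-allFin-1 N ⟩
      N                                                    ∎

  ∑-allFin-𝟙≡ᵇ : ∀ B v → v < B → ∑[ c ∈ allFin B ] 𝟙 (v ≡ᵇ toℕ c) ≡ 1
  ∑-allFin-𝟙≡ᵇ (suc B) zero    _         =
    trans (∑-allFin-suc {B} (λ c → 𝟙 (0 ≡ᵇ toℕ c))) (cong suc (∑-zero (allFin B)))
  ∑-allFin-𝟙≡ᵇ (suc B) (suc v) (s≤s v<B) =
    trans (∑-allFin-suc {B} (λ c → 𝟙 (suc v ≡ᵇ toℕ c))) (∑-allFin-𝟙≡ᵇ B v v<B)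

  all-allFin-suc : ∀ {N} (p : Fin (suc N) → Bool) → all p (allFin (suc N)) ≡ p zero ∧ all (p ∘ suc) (allFin N)
  all-allFin-suc p = cong and (map-allFin-suc p)

  all-≡ᵇ⇒≗ : ∀ {N} (h e : Fin N → ℕ) → all (λ c → h c ≡ᵇ e c) (allFin N) ≡ true → ∀ c → h c ≡ e c
  all-≡ᵇ⇒≗ {N} h e all≡true c =
    ℕ.≡ᵇ⇒≡ _ _ (All.lookup (all⁺ _ (allFin N) (Equivalence.from T-≡ all≡true)) (∈-allFin c))

  -- Colour classes and homogeneous parts of X_G

  hasColourCounts : ∀ {s N} → (Fin s → Fin N) → (Fin N → ℕ) → Bool
  hasColourCounts {N = N} κ e = all (λ c → colourCount κ c ≡ᵇ e c) (allFin N)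

  colourCount-∑ : ∀ {s N} (κ : Fin s → Fin N) c → colourCount κ c ≡ ∑[ i ∈ allFin s ] 𝟙 ⌊ κ i ≟ c ⌋
  colourCount-∑ {s} κ c = countB-map (λ i → ⌊ κ i ≟ c ⌋) (allFin s)

  ∑-colourCount : ∀ {s N} (κ : Fin s → Fin N) → ∑ (allFin N) (colourCount κ) ≡ s
  ∑-colourCount {s} {N} κ = begin
    ∑ (allFin N) (colourCount κ)                          ≡⟨ ∑-cong (allFin N) (colourCount-∑ κ) ⟩
    ∑[ c ∈ allFin N ] ∑[ i ∈ allFin s ] 𝟙 ⌊ κ i ≟ c ⌋     ≡⟨ ∑-comm (allFin N) (allFin s) _ ⟩
    ∑[ i ∈ allFin s ] ∑[ c ∈ allFin N ] 𝟙 ⌊ κ i ≟ c ⌋     ≡⟨ ∑-cong (allFin s) (λ i → ∑-allFin-𝟙≟ (κ i)) ⟩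
    ∑[ _ ∈ allFin s ] 1                                   ≡⟨ ∑-allFin-1 s ⟩
    s                                                     ∎

  colourCount≤ : ∀ {s N} (κ : Fin s → Fin N) c → colourCount κ c ≤ s
  colourCount≤ {s} κ c = ℕ.≤-trans (ℕ.≤-reflexive (colourCount-∑ κ c))
    (ℕ.≤-trans (∑-𝟙≤length (allFin s) (λ i → ⌊ κ i ≟ c ⌋)) (ℕ.≤-reflexive (length-tabulate id)))

  ∑-allFuns-exact : ∀ N B (h : Fin N → ℕ) → (∀ c → h c < B) →
                    ∑[ g ∈ allFuns N B ] 𝟙 (all (λ c → h c ≡ᵇ toℕ (g c)) (allFin N)) ≡ 1
  ∑-allFuns-exact zero    B h h<B = refl
  ∑-allFuns-exact (suc N) B h h<B = begin
    ∑[ g ∈ allFuns (suc N) B ] 𝟙 (all (λ c → h c ≡ᵇ toℕ (g c)) (allFin (suc N)))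
      ≡⟨ ∑-concatMap (allFin B) (λ b → map (b ◂_) (allFuns N B)) _ ⟩
    ∑[ b ∈ allFin B ] ∑ (map (b ◂_) (allFuns N B)) (λ g → 𝟙 (all (λ c → h c ≡ᵇ toℕ (g c)) (allFin (suc N))))
      ≡⟨ ∑-cong (allFin B) (λ b → ∑-map (allFuns N B) (b ◂_) _) ⟩
    ∑[ b ∈ allFin B ] ∑[ f ∈ allFuns N B ] 𝟙 (all (λ c → h c ≡ᵇ toℕ ((b ◂ f) c)) (allFin (suc N)))
      ≡⟨ ∑-cong (allFin B) (λ b → ∑-cong (allFuns N B) (λ f → head-tail b f)) ⟩
    ∑[ b ∈ allFin B ] ∑[ f ∈ allFuns N B ] (𝟙 (h zero ≡ᵇ toℕ b) * tailMatches f)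
      ≡⟨ ∑-cong (allFin B) (λ b → ∑-*ˡ (allFuns N B) (𝟙 (h zero ≡ᵇ toℕ b)) tailMatches) ⟩
    ∑[ b ∈ allFin B ] (𝟙 (h zero ≡ᵇ toℕ b) * ∑ (allFuns N B) tailMatches)
      ≡⟨ ∑-cong (allFin B) (λ b → cong (𝟙 (h zero ≡ᵇ toℕ b) *_) (∑-allFuns-exact N B (h ∘ suc) (h<B ∘ suc))) ⟩
    ∑[ b ∈ allFin B ] (𝟙 (h zero ≡ᵇ toℕ b) * 1)
      ≡⟨ ∑-cong (allFin B) (λ b → ℕ.*-identityʳ _) ⟩
    ∑[ b ∈ allFin B ] 𝟙 (h zero ≡ᵇ toℕ b)
      ≡⟨ ∑-allFin-𝟙≡ᵇ B (h zero) (h<B zero) ⟩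
    1 ∎
    where
    tailMatches : (Fin N → Fin B) → ℕ
    tailMatches f = 𝟙 (all (λ c → h (suc c) ≡ᵇ toℕ (f c)) (allFin N))
    head-tail : ∀ b f → 𝟙 (all (λ c → h c ≡ᵇ toℕ ((b ◂ f) c)) (allFin (suc N)))
                        ≡ 𝟙 (h zero ≡ᵇ toℕ b) * tailMatches f
    head-tail b f = trans (cong 𝟙 (all-allFin-suc (λ c → h c ≡ᵇ toℕ ((b ◂ f) c))))
                          (𝟙-∧ (h zero ≡ᵇ toℕ b) (all (λ c → h (suc c) ≡ᵇ toℕ (f c)) (allFin N)))

  -- The sum of the coefficients of the degree-d monomials of X in x₁ … x_N. Their exponent vectors
  -- have entries ≤ d, so they are enumerated as maps Fin N → Fin (suc d).
  degreePart : ∀ {s} → (Fin s → Fin s → Bool) → (N d : ℕ) → ℕ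
  degreePart a N d = ∑[ g ∈ allFuns N (suc d) ] (𝟙 (∑ (allFin N) (toℕ ∘ g) ≡ᵇ d) * xCoeff a N (toℕ ∘ g))

  xCoeff-∑ : ∀ {s} (a : Fin s → Fin s → Bool) N e →
             xCoeff a N e ≡ ∑[ κ ∈ allFuns s N ] (𝟙 (proper a κ) * 𝟙 (hasColourCounts κ e))
  xCoeff-∑ {s} a N e =
    trans (countB-map _ (allFuns s N)) (∑-cong (allFuns s N) (λ κ → 𝟙-∧ (proper a κ) (hasColourCounts κ e)))

  -- κ contributes only to the exponent vector of its colour counts, whose degree is s.
  ∑-colourCounts-of-degree : ∀ {s N} d (κ : Fin s → Fin N) →
    ∑[ g ∈ allFuns N (suc d) ] (𝟙 (∑ (allFin N) (toℕ ∘ g) ≡ᵇ d) * 𝟙 (hasColourCounts κ (toℕ ∘ g)))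
      ≡ 𝟙 (s ≡ᵇ d)
  ∑-colourCounts-of-degree {s} {N} d κ = begin
    ∑[ g ∈ gs ] (𝟙 (∑ (allFin N) (toℕ ∘ g) ≡ᵇ d) * counts g) ≡⟨ ∑-cong gs degree≡s ⟩
    ∑[ g ∈ gs ] (𝟙 (s ≡ᵇ d) * counts g)                     ≡⟨ ∑-*ˡ gs (𝟙 (s ≡ᵇ d)) counts ⟩
    𝟙 (s ≡ᵇ d) * ∑ gs counts                                ≡⟨ unique (s ≡ᵇ d) ≡.refl ⟩
    𝟙 (s ≡ᵇ d)                                              ∎
    where
    gs = allFuns N (suc d)
    counts : (Fin N → Fin (suc d)) → ℕ
    counts g = 𝟙 (hasColourCounts κ (toℕ ∘ g))
    degree≡s : ∀ g → 𝟙 (∑ (allFin N) (toℕ ∘ g) ≡ᵇ d) * counts g ≡ 𝟙 (s ≡ᵇ d) * counts g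
    degree≡s g with hasColourCounts κ (toℕ ∘ g) in matches
    ... | false = trans (ℕ.*-zeroʳ (𝟙 (∑ (allFin N) (toℕ ∘ g) ≡ᵇ d))) (sym (ℕ.*-zeroʳ (𝟙 (s ≡ᵇ d))))
    ... | true  = cong (λ t → 𝟙 (t ≡ᵇ d) * 1)
                       (trans (sym (∑-cong (allFin N) (all-≡ᵇ⇒≗ (colourCount κ) (toℕ ∘ g) matches))) (∑-colourCount κ))
    unique : ∀ b → (s ≡ᵇ d) ≡ b → 𝟙 b * ∑ gs counts ≡ 𝟙 b
    unique false _    = refl
    unique true  s≡d rewrite ℕ.≡ᵇ⇒≡ s d (Equivalence.from T-≡ s≡d) =
      cong (_+ 0) (∑-allFuns-exact N (suc d) (colourCount κ) (λ c → s≤s (colourCount≤ κ c)))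

  degreePart≡ : ∀ {s} (a : Fin s → Fin s → Bool) N d → degreePart a N d ≡ 𝟙 (s ≡ᵇ d) * numColourings a N
  degreePart≡ {s} a N d = begin
    degreePart a N d
      ≡⟨ ∑-cong gs (λ g → cong (w g *_) (xCoeff-∑ a N (toℕ ∘ g))) ⟩
    ∑[ g ∈ gs ] (w g * ∑[ κ ∈ κs ] (proper′ κ * counts κ g))
      ≡⟨ ∑-*-∑-comm gs κs w proper′ counts ⟩
    ∑[ κ ∈ κs ] (proper′ κ * ∑[ g ∈ gs ] (w g * counts κ g))
      ≡⟨ ∑-cong κs (λ κ → cong (proper′ κ *_) (∑-colourCounts-of-degree d κ)) ⟩
    ∑[ κ ∈ κs ] (proper′ κ * 𝟙 (s ≡ᵇ d))
      ≡⟨ ∑-*ʳ κs (𝟙 (s ≡ᵇ d)) proper′ ⟩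
    ∑ κs proper′ * 𝟙 (s ≡ᵇ d)
      ≡⟨ trans (ℕ.*-comm (𝟙 (s ≡ᵇ d)) _) (cong (_* 𝟙 (s ≡ᵇ d)) (countB-map (proper a) κs)) ⟨
    𝟙 (s ≡ᵇ d) * numColourings a N
      ∎
    where
    gs = allFuns N (suc d)
    κs = allFuns s N
    w : (Fin N → Fin (suc d)) → ℕ
    w g = 𝟙 (∑ (allFin N) (toℕ ∘ g) ≡ᵇ d)
    proper′ : (Fin s → Fin N) → ℕ
    proper′ κ = 𝟙 (proper a κ)
    counts : (Fin s → Fin N) → (Fin N → Fin (suc d)) → ℕ
    counts κ g = 𝟙 (hasColourCounts κ (toℕ ∘ g))

  -- Proper colourings of path forests

  all-cong : {p q : B → Bool} (xs : List B) → (∀ x → p x ≡ q x) → all p xs ≡ all q xs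
  all-cong xs p≗q = cong and (map-cong p≗q xs)

  all-∧ : (p q : B → Bool) (xs : List B) → all (λ x → p x ∧ q x) xs ≡ all p xs ∧ all q xs
  all-∧ p q []       = refl
  all-∧ p q (x ∷ xs) with p x | q x
  ... | false | _     = refl
  ... | true  | false = sym (∧-zeroʳ (all p xs))
  ... | true  | true  = all-∧ p q xs

  all-true : (p : B → Bool) (xs : List B) → (∀ x → p x ≡ true) → all p xs ≡ true
  all-true p []       p≡true = refl
  all-true p (x ∷ xs) p≡true rewrite p≡true x = all-true p xs p≡true

  proper-cong : ∀ {s N} (a b : Fin s → Fin s → Bool) → (∀ i j → a i j ≡ b i j) →
                (κ : Fin s → Fin N) → proper a κ ≡ proper b κ
  proper-cong {s} a b a≗b κ =
    all-cong (allFin s) (λ i → all-cong (allFin s) (λ j → cong (λ e → not e ∨ not ⌊ κ i ≟ κ j ⌋) (a≗b i j)))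

  numColourings-cong : ∀ {s} (a b : Fin s → Fin s → Bool) → (∀ i j → a i j ≡ b i j) →
                       ∀ N → numColourings a N ≡ numColourings b N
  numColourings-cong {s} a b a≗b N = cong countB (map-cong (proper-cong a b a≗b) (allFuns s N))

  dropFirst : ∀ {s} → (Fin (suc s) → Fin (suc s) → Bool) → Fin s → Fin s → Bool
  dropFirst a i j = a (suc i) (suc j)

  avoidsNeighbours₀ : ∀ {s N} → (Fin (suc s) → Fin (suc s) → Bool) → Fin N → (Fin s → Fin N) → Bool
  avoidsNeighbours₀ {s} a c f = all (λ j → not (a zero (suc j)) ∨ not ⌊ c ≟ f j ⌋) (allFin s)

  module _ {s} (a : Fin (suc s) → Fin (suc s) → Bool) (loopless₀ : a zero zero ≡ false)
           (symmetric₀ : ∀ i → a (suc i) zero ≡ a zero (suc i)) where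

    proper-◂ : ∀ {N} (c : Fin N) (f : Fin s → Fin N) →
               proper a (c ◂ f) ≡ avoidsNeighbours₀ a c f ∧ proper (dropFirst a) f
    proper-◂ c f = begin
      proper a (c ◂ f)
        ≡⟨ all-allFin-suc (λ i → all (ok i) (allFin (suc s))) ⟩
      all (ok zero) (allFin (suc s)) ∧ all (λ i → all (ok (suc i)) (allFin (suc s))) (allFin s)
        ≡⟨ cong₂ _∧_ row₀ (trans (all-cong (allFin s) rowᵢ) (all-∧ _ _ (allFin s))) ⟩
      avoidsNeighbours₀ a c f ∧ (avoidsNeighbours₀ a c f ∧ proper (dropFirst a) f)
        ≡⟨ ∧-assoc (avoidsNeighbours₀ a c f) (avoidsNeighbours₀ a c f) (proper (dropFirst a) f) ⟨
      (avoidsNeighbours₀ a c f ∧ avoidsNeighbours₀ a c f) ∧ proper (dropFirst a) f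
        ≡⟨ cong (_∧ proper (dropFirst a) f) (∧-idem _) ⟩
      avoidsNeighbours₀ a c f ∧ proper (dropFirst a) f
        ∎
      where
      ok : Fin (suc s) → Fin (suc s) → Bool
      ok i j = not (a i j) ∨ not ⌊ (c ◂ f) i ≟ (c ◂ f) j ⌋
      row₀ : all (ok zero) (allFin (suc s)) ≡ avoidsNeighbours₀ a c f
      row₀ = trans (all-allFin-suc (ok zero))
                   (cong (λ e → (not e ∨ not ⌊ c ≟ c ⌋) ∧ avoidsNeighbours₀ a c f) loopless₀)
      restRow : Fin s → Bool
      restRow i = all (λ j → not (dropFirst a i j) ∨ not ⌊ f i ≟ f j ⌋) (allFin s)
      rowᵢ : ∀ i → all (ok (suc i)) (allFin (suc s)) ≡ (not (a zero (suc i)) ∨ not ⌊ c ≟ f i ⌋) ∧ restRow i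
      rowᵢ i = trans (all-allFin-suc (ok (suc i)))
                     (cong₂ (λ e e′ → (not e ∨ not e′) ∧ restRow i) (symmetric₀ i) (≟-sym (f i) c))

    numColourings-◂ : ∀ N → numColourings a N ≡
      ∑[ c ∈ allFin N ] ∑[ f ∈ allFuns s N ] (𝟙 (avoidsNeighbours₀ a c f) * 𝟙 (proper (dropFirst a) f))
    numColourings-◂ N = begin
      numColourings a N
        ≡⟨ countB-map (proper a) (allFuns (suc s) N) ⟩
      ∑ (allFuns (suc s) N) (𝟙 ∘ proper a)
        ≡⟨ ∑-concatMap (allFin N) (λ c → map (c ◂_) (allFuns s N)) _ ⟩
      ∑[ c ∈ allFin N ] ∑ (map (c ◂_) (allFuns s N)) (𝟙 ∘ proper a)
        ≡⟨ ∑-cong (allFin N) (λ c → ∑-map (allFuns s N) (c ◂_) _) ⟩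
      ∑[ c ∈ allFin N ] ∑[ f ∈ allFuns s N ] 𝟙 (proper a (c ◂ f))
        ≡⟨ ∑-cong (allFin N) (λ c → ∑-cong (allFuns s N) (λ f →
             trans (cong 𝟙 (proper-◂ c f)) (𝟙-∧ (avoidsNeighbours₀ a c f) (proper (dropFirst a) f)))) ⟩
      ∑[ c ∈ allFin N ] ∑[ f ∈ allFuns s N ] (𝟙 (avoidsNeighbours₀ a c f) * 𝟙 (proper (dropFirst a) f))
        ∎

    numColourings-isolated₀ : (∀ j → a zero (suc j) ≡ false) →
                              ∀ N → numColourings a N ≡ N * numColourings (dropFirst a) N
    numColourings-isolated₀ isolated N = begin
      numColourings a N
        ≡⟨ numColourings-◂ N ⟩
      ∑[ c ∈ allFin N ] ∑[ f ∈ allFuns s N ] (𝟙 (avoidsNeighbours₀ a c f) * 𝟙 (proper (dropFirst a) f))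
        ≡⟨ ∑-cong (allFin N) (λ c → ∑-cong (allFuns s N) (λ f → cong (λ b → 𝟙 b * _) (avoids c f))) ⟩
      ∑[ c ∈ allFin N ] ∑[ f ∈ allFuns s N ] (1 * 𝟙 (proper (dropFirst a) f))
        ≡⟨ ∑-cong (allFin N) (λ c → trans (∑-cong (allFuns s N) (λ f → ℕ.*-identityˡ _))
                                          (sym (countB-map (proper (dropFirst a)) (allFuns s N)))) ⟩
      ∑[ _ ∈ allFin N ] numColourings (dropFirst a) N
        ≡⟨ ∑-allFin-const N _ ⟩
      N * numColourings (dropFirst a) N
        ∎
      where
      avoids : ∀ c f → avoidsNeighbours₀ a c f ≡ true
      avoids c f = all-true _ (allFin s) (λ j → cong (λ e → not e ∨ not ⌊ c ≟ f j ⌋) (isolated j))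

  numColourings-leaf₀ : ∀ {s} (a : Fin (suc (suc s)) → Fin (suc (suc s)) → Bool) →
    a zero zero ≡ false → (∀ i → a (suc i) zero ≡ a zero (suc i)) →
    a zero (suc zero) ≡ true → (∀ j → a zero (suc (suc j)) ≡ false) →
    ∀ N → numColourings a N ≡ (N ∸ 1) * numColourings (dropFirst a) N
  numColourings-leaf₀ {s} a loopless₀ symmetric₀ edge₀₁ nonEdges N = begin
    numColourings a N
      ≡⟨ numColourings-◂ a loopless₀ symmetric₀ N ⟩
    ∑[ c ∈ allFin N ] ∑[ f ∈ fs ] (𝟙 (avoidsNeighbours₀ a c f) * properRest f)
      ≡⟨ ∑-cong (allFin N) (λ c → ∑-cong fs (λ f → cong (λ b → 𝟙 b * properRest f) (avoids c f))) ⟩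
    ∑[ c ∈ allFin N ] ∑[ f ∈ fs ] (𝟙 (not ⌊ c ≟ f zero ⌋) * properRest f)
      ≡⟨ ∑-comm (allFin N) fs _ ⟩
    ∑[ f ∈ fs ] ∑[ c ∈ allFin N ] (𝟙 (not ⌊ c ≟ f zero ⌋) * properRest f)
      ≡⟨ ∑-cong fs (λ f → ∑-*ʳ (allFin N) (properRest f) _) ⟩
    ∑[ f ∈ fs ] (∑[ c ∈ allFin N ] 𝟙 (not ⌊ c ≟ f zero ⌋) * properRest f)
      ≡⟨ ∑-cong fs (λ f → cong (_* properRest f) (∑-allFin-𝟙≢ (f zero))) ⟩
    ∑[ f ∈ fs ] ((N ∸ 1) * properRest f)
      ≡⟨ ∑-*ˡ fs (N ∸ 1) properRest ⟩
    (N ∸ 1) * ∑ fs properRest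
      ≡⟨ cong ((N ∸ 1) *_) (countB-map (proper (dropFirst a)) fs) ⟨
    (N ∸ 1) * numColourings (dropFirst a) N
      ∎
    where
    fs = allFuns (suc s) N
    properRest : (Fin (suc s) → Fin N) → ℕ
    properRest f = 𝟙 (proper (dropFirst a) f)
    avoids : ∀ c f → avoidsNeighbours₀ a c f ≡ not ⌊ c ≟ f zero ⌋
    avoids c f = begin
      avoidsNeighbours₀ a c f
        ≡⟨ all-allFin-suc {s} (λ j → not (a zero (suc j)) ∨ not ⌊ c ≟ f j ⌋) ⟩
      (not (a zero (suc zero)) ∨ not ⌊ c ≟ f zero ⌋)
        ∧ all (λ j → not (a zero (suc (suc j))) ∨ not ⌊ c ≟ f (suc j) ⌋) (allFin s)
        ≡⟨ cong₂ (λ e e′ → (not e ∨ not ⌊ c ≟ f zero ⌋) ∧ e′) edge₀₁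
             (all-true _ (allFin s) (λ j → cong (λ e → not e ∨ not ⌊ c ≟ f (suc j) ⌋) (nonEdges j))) ⟩
      not ⌊ c ≟ f zero ⌋ ∧ true
        ≡⟨ ∧-identityʳ _ ⟩
      not ⌊ c ≟ f zero ⌋
        ∎

  pathAdj-sym : ∀ λs (i j : Fin (sum λs)) → pathAdj λs i j ≡ pathAdj λs j i
  pathAdj-sym λs i j = ∨-comm (step i j) (step j i)
    where
    step : Fin (sum λs) → Fin (sum λs) → Bool
    step u v = (suc (toℕ u) ≡ᵇ toℕ v) ∧ not (any (λ t → t ≡ᵇ toℕ v) (cuts λs))

  private
    cuts-suc : ∀ a r J → any (λ t → t ≡ᵇ suc J) (cuts (suc a ∷ r)) ≡ any (λ t → t ≡ᵇ J) (cuts (a ∷ r))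
    cuts-suc a r J = cong ((a ≡ᵇ J) ∨_) (cong or (trans (sym (map-∘ (cuts r))) (map-∘ (cuts r))))

    cuts-0∷ : ∀ r U V → (suc U ≡ᵇ V) ∧ not (any (λ t → t ≡ᵇ V) (cuts (0 ∷ r)))
                      ≡ (suc U ≡ᵇ V) ∧ not (any (λ t → t ≡ᵇ V) (cuts r))
    cuts-0∷ r U zero    = refl
    cuts-0∷ r U (suc V) = cong (λ ts → (U ≡ᵇ V) ∧ not (or (map (λ t → t ≡ᵇ suc V) ts))) (map-id (cuts r))

  pathAdj-dropFirst : ∀ a r (i j : Fin (sum (a ∷ r))) → dropFirst (pathAdj (suc a ∷ r)) i j ≡ pathAdj (a ∷ r) i j
  pathAdj-dropFirst a r i j =
    cong₂ (λ x y → ((suc (toℕ i) ≡ᵇ toℕ j) ∧ not x) ∨ ((suc (toℕ j) ≡ᵇ toℕ i) ∧ not y))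
          (cuts-suc a r (toℕ j)) (cuts-suc a r (toℕ i))

  pathAdj-0∷ : ∀ r (i j : Fin (sum r)) → pathAdj (0 ∷ r) i j ≡ pathAdj r i j
  pathAdj-0∷ r i j = cong₂ _∨_ (cuts-0∷ r (toℕ i) (toℕ j)) (cuts-0∷ r (toℕ j) (toℕ i))

  pathAdj-isolated₀ : ∀ r (j : Fin (sum r)) → pathAdj (1 ∷ r) zero (suc j) ≡ false
  pathAdj-isolated₀ r j = isolated (toℕ j) _
    where
    isolated : ∀ J cut → ((0 ≡ᵇ J) ∧ not ((0 ≡ᵇ J) ∨ cut)) ∨ false ≡ false
    isolated zero    cut = refl
    isolated (suc J) cut = refl

  pathAdj-edge₀₁ : ∀ b r → pathAdj (suc (suc b) ∷ r) zero (suc zero) ≡ true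
  pathAdj-edge₀₁ b r = cong (λ x → not x ∨ false) (trans (cong or (sym (map-∘ (cuts r)))) (noCut (cuts r)))
    where
    noCut : (ts : List ℕ) → or (map (λ _ → false) ts) ≡ false
    noCut []       = refl
    noCut (_ ∷ ts) = noCut ts

  pathAdj-nonEdge₀ : ∀ b r (j : Fin (b + sum r)) → pathAdj (suc (suc b) ∷ r) zero (suc (suc j)) ≡ false
  pathAdj-nonEdge₀ b r j = refl

  -- χ-block N a v = χ_{P_a}(N) · v, where χ_{P_a}(N) = N (N ∸ 1)^(a ∸ 1) for a ≥ 1 and χ_{P_0} = 1.
  χ-block : ℕ → ℕ → ℕ → ℕ
  χ-block N zero          v = v
  χ-block N (suc zero)    v = N * v
  χ-block N (suc (suc a)) v = (N ∸ 1) * χ-block N (suc a) v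

  χ-paths : ℕ → List ℕ → ℕ
  χ-paths N []      = 1
  χ-paths N (a ∷ r) = χ-block N a (χ-paths N r)

  numColourings-pathAdj-∷ : ∀ N a r → numColourings (pathAdj r) N ≡ χ-paths N r →
                            numColourings (pathAdj (a ∷ r)) N ≡ χ-block N a (χ-paths N r)
  numColourings-pathAdj-∷ N zero r ih = trans (numColourings-cong _ _ (pathAdj-0∷ r) N) ih
  numColourings-pathAdj-∷ N (suc zero) r ih = begin
    numColourings (pathAdj (1 ∷ r)) N
      ≡⟨ numColourings-isolated₀ (pathAdj (1 ∷ r)) refl symmetric₀ (pathAdj-isolated₀ r) N ⟩
    N * numColourings (dropFirst (pathAdj (1 ∷ r))) N
      ≡⟨ cong (N *_) (numColourings-cong _ _ (λ i j → trans (pathAdj-dropFirst 0 r i j) (pathAdj-0∷ r i j)) N) ⟩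
    N * numColourings (pathAdj r) N
      ≡⟨ cong (N *_) ih ⟩
    N * χ-paths N r
      ∎
    where
    symmetric₀ : ∀ i → pathAdj (1 ∷ r) (suc i) zero ≡ pathAdj (1 ∷ r) zero (suc i)
    symmetric₀ i = pathAdj-sym (1 ∷ r) (suc i) zero
  numColourings-pathAdj-∷ N (suc (suc b)) r ih = begin
    numColourings (pathAdj (suc (suc b) ∷ r)) N
      ≡⟨ numColourings-leaf₀ (pathAdj (suc (suc b) ∷ r)) refl symmetric₀
           (pathAdj-edge₀₁ b r) (pathAdj-nonEdge₀ b r) N ⟩
    (N ∸ 1) * numColourings (dropFirst (pathAdj (suc (suc b) ∷ r))) N
      ≡⟨ cong ((N ∸ 1) *_) (numColourings-cong _ _ (pathAdj-dropFirst (suc b) r) N) ⟩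
    (N ∸ 1) * numColourings (pathAdj (suc b ∷ r)) N
      ≡⟨ cong ((N ∸ 1) *_) (numColourings-pathAdj-∷ N (suc b) r ih) ⟩
    (N ∸ 1) * χ-block N (suc b) (χ-paths N r)
      ∎
    where
    symmetric₀ : ∀ i → pathAdj (suc (suc b) ∷ r) (suc i) zero ≡ pathAdj (suc (suc b) ∷ r) zero (suc i)
    symmetric₀ i = pathAdj-sym (suc (suc b) ∷ r) (suc i) zero

  numColourings-pathAdj : ∀ N λs → numColourings (pathAdj λs) N ≡ χ-paths N λs
  numColourings-pathAdj N []      = refl
  numColourings-pathAdj N (a ∷ r) = numColourings-pathAdj-∷ N a r (numColourings-pathAdj N r)

module Polynomials where

  open import Data.Rational.Base using (mkℚ; 0ℚ; 1ℚ; _+_; _*_; -_; 1/_)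
  open import Data.Rational.Solver using (module +-*-Solver)
  open +-*-Solver
  open ℚ-Sum
  open Colourings using (𝟙; χ-block; χ-paths; degreePart; degreePart≡; numColourings-pathAdj)
  open import Data.Nat.Base using (_≡ᵇ_)
  open import Data.Nat.Combinatorics using (_C_; nCk+nC[k+1]≡[n+1]C[k+1])
  open ≡ using (refl; sym; trans; cong; cong₂; subst)
  open ≡.≡-Reasoning

  private variable B : Set

  ℕ→ℚ-mkℚ : ∀ n → ℕ→ℚ n ≡ mkℚ (ℤ.+ n) 0 (Coprime.sym (Coprime.1-coprimeTo n))
  ℕ→ℚ-mkℚ n = ℚ.normalize-coprime (Coprime.sym (Coprime.1-coprimeTo n))

  ℕ→ℚ-+ : ∀ m n → ℕ→ℚ (m ℕ.+ n) ≡ ℕ→ℚ m + ℕ→ℚ n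
  ℕ→ℚ-+ m n rewrite ℕ→ℚ-mkℚ m | ℕ→ℚ-mkℚ n =
    sym (ℚ./-cong {p₂ = ℤ.+ (m ℕ.+ n)} {q₂ = 1} (cong₂ ℤ._+_ (ℤ.*-identityʳ (ℤ.+ m)) (ℤ.*-identityʳ (ℤ.+ n))) refl)

  ℕ→ℚ-* : ∀ m n → ℕ→ℚ (m ℕ.* n) ≡ ℕ→ℚ m * ℕ→ℚ n
  ℕ→ℚ-* m n rewrite ℕ→ℚ-mkℚ m | ℕ→ℚ-mkℚ n =
    sym (ℚ./-cong {p₂ = ℤ.+ (m ℕ.* n)} {q₂ = 1} (ℤ.+◃n≡+n (m ℕ.* n)) refl)

  ℕ→ℚ-∑ : (xs : List B) (f : B → ℕ) → ℕ→ℚ (ℕ-Sum.∑ xs f) ≡ ∑ xs (ℕ→ℚ ∘ f)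
  ℕ→ℚ-∑ []       f = refl
  ℕ→ℚ-∑ (x ∷ xs) f = trans (ℕ→ℚ-+ (f x) (ℕ-Sum.∑ xs f)) (cong (ℕ→ℚ (f x) +_) (ℕ→ℚ-∑ xs f))

  ℕ→ℚ-suc-cancelˡ : ∀ j y → ℕ→ℚ (suc j) * y ≡ 0ℚ → y ≡ 0ℚ
  ℕ→ℚ-suc-cancelˡ j y 1+j*y≡0 rewrite ℕ→ℚ-mkℚ (suc j) = begin
    y                ≡⟨ ℚ.*-identityˡ y ⟨
    1ℚ * y           ≡⟨ cong (_* y) (ℚ.*-inverseˡ z) ⟨
    (1/ z * z) * y   ≡⟨ ℚ.*-assoc (1/ z) z y ⟩
    1/ z * (z * y)   ≡⟨ cong (1/ z *_) 1+j*y≡0 ⟩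
    1/ z * 0ℚ        ≡⟨ ℚ.*-zeroʳ (1/ z) ⟩
    0ℚ               ∎
    where
    z = mkℚ (ℤ.+ suc j) 0 (Coprime.sym (Coprime.1-coprimeTo (suc j)))

  infixl 6 _+ₚ_
  infixr 7 _·ₚ_
  infix  4 _≈ₚ_

  _+ₚ_ : List ℚ → List ℚ → List ℚ
  []      +ₚ q       = q
  (a ∷ p) +ₚ []      = a ∷ p
  (a ∷ p) +ₚ (b ∷ q) = (a + b) ∷ (p +ₚ q)

  _·ₚ_ : ℚ → List ℚ → List ℚ
  a ·ₚ p = map (a *_) p

  _≈ₚ_ : List ℚ → List ℚ → Set
  p ≈ₚ q = ∀ m → coeff p m ≡ coeff q m

  coeff-+ₚ : ∀ p q m → coeff (p +ₚ q) m ≡ coeff p m + coeff q m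
  coeff-+ₚ []      q       m       = sym (ℚ.+-identityˡ _)
  coeff-+ₚ (a ∷ p) []      zero    = sym (ℚ.+-identityʳ a)
  coeff-+ₚ (a ∷ p) []      (suc m) = sym (ℚ.+-identityʳ _)
  coeff-+ₚ (a ∷ p) (b ∷ q) zero    = refl
  coeff-+ₚ (a ∷ p) (b ∷ q) (suc m) = coeff-+ₚ p q m

  coeff-·ₚ : ∀ a p m → coeff (a ·ₚ p) m ≡ a * coeff p m
  coeff-·ₚ a []      m       = sym (ℚ.*-zeroʳ a)
  coeff-·ₚ a (c ∷ p) zero    = refl
  coeff-·ₚ a (c ∷ p) (suc m) = coeff-·ₚ a p m

  coeff-beyond-length : ∀ p m → length p ≤ m → coeff p m ≡ 0ℚ
  coeff-beyond-length []      m       _         = refl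
  coeff-beyond-length (a ∷ p) (suc m) (s≤s p≤m) = coeff-beyond-length p m p≤m

  eval-+ₚ : ∀ p q x → evalPoly (p +ₚ q) x ≡ evalPoly p x + evalPoly q x
  eval-+ₚ []      q       x = sym (ℚ.+-identityˡ _)
  eval-+ₚ (a ∷ p) []      x = sym (ℚ.+-identityʳ _)
  eval-+ₚ (a ∷ p) (b ∷ q) x rewrite eval-+ₚ p q x =
    solve 5 (λ a b x e f → (a :+ b) :+ x :* (e :+ f) := (a :+ x :* e) :+ (b :+ x :* f)) refl
      a b x (evalPoly p x) (evalPoly q x)

  eval-·ₚ : ∀ a p x → evalPoly (a ·ₚ p) x ≡ a * evalPoly p x
  eval-·ₚ a []      x = sym (ℚ.*-zeroʳ a)
  eval-·ₚ a (c ∷ p) x rewrite eval-·ₚ a p x =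
    solve 4 (λ a c x e → a :* c :+ x :* (a :* e) := a :* (c :+ x :* e)) refl a c x (evalPoly p x)

  length-+ₚ : ∀ p q n → length p ≤ n → length q ≤ n → length (p +ₚ q) ≤ n
  length-+ₚ []      q       n       p≤n       q≤n       = q≤n
  length-+ₚ (a ∷ p) []      n       p≤n       q≤n       = p≤n
  length-+ₚ (a ∷ p) (b ∷ q) (suc n) (s≤s p≤n) (s≤s q≤n) = s≤s (length-+ₚ p q n p≤n q≤n)

  ∑ₚ : List B → (B → List ℚ) → List ℚ
  ∑ₚ xs f = foldr _+ₚ_ [] (map f xs)

  coeff-∑ₚ : (xs : List B) (f : B → List ℚ) (m : ℕ) → coeff (∑ₚ xs f) m ≡ ∑[ x ∈ xs ] coeff (f x) m
  coeff-∑ₚ []       f m = refl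
  coeff-∑ₚ (x ∷ xs) f m = trans (coeff-+ₚ (f x) (∑ₚ xs f) m) (cong (coeff (f x) m +_) (coeff-∑ₚ xs f m))

  eval-∑ₚ : (xs : List B) (f : B → List ℚ) (y : ℚ) → evalPoly (∑ₚ xs f) y ≡ ∑[ x ∈ xs ] evalPoly (f x) y
  eval-∑ₚ []       f y = refl
  eval-∑ₚ (x ∷ xs) f y = trans (eval-+ₚ (f x) (∑ₚ xs f) y) (cong (evalPoly (f x) y +_) (eval-∑ₚ xs f y))

  eval-0 : ∀ p → evalPoly p 0ℚ ≡ coeff p 0
  eval-0 []      = refl
  eval-0 (c ∷ p) = trans (cong (c +_) (ℚ.*-zeroˡ (evalPoly p 0ℚ))) (ℚ.+-identityʳ c)

  [x-1]*ᶜ : (ℕ → ℚ) → ℕ → ℚ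
  [x-1]*ᶜ f zero    = 0ℚ + (- 1ℚ) * f 0
  [x-1]*ᶜ f (suc m) = f m + (- 1ℚ) * f (suc m)

  [x-1]*_ : List ℚ → List ℚ
  [x-1]* p = (0ℚ ∷ p) +ₚ (- 1ℚ) ·ₚ p

  coeff-[x-1]* : ∀ p k → coeff ([x-1]* p) k ≡ [x-1]*ᶜ (coeff p) k
  coeff-[x-1]* p zero    = trans (coeff-+ₚ (0ℚ ∷ p) ((- 1ℚ) ·ₚ p) 0) (cong (0ℚ +_) (coeff-·ₚ (- 1ℚ) p 0))
  coeff-[x-1]* p (suc k) = trans (coeff-+ₚ (0ℚ ∷ p) ((- 1ℚ) ·ₚ p) (suc k)) (cong (coeff p k +_) (coeff-·ₚ (- 1ℚ) p (suc k)))

  eval-[x-1]* : ∀ p x → evalPoly ([x-1]* p) x ≡ (x + - 1ℚ) * evalPoly p x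
  eval-[x-1]* p x = begin
    evalPoly ([x-1]* p) x                       ≡⟨ eval-+ₚ (0ℚ ∷ p) ((- 1ℚ) ·ₚ p) x ⟩
    (0ℚ + x * evalPoly p x) + evalPoly ((- 1ℚ) ·ₚ p) x ≡⟨ cong ((0ℚ + x * evalPoly p x) +_) (eval-·ₚ (- 1ℚ) p x) ⟩
    (0ℚ + x * evalPoly p x) + (- 1ℚ) * evalPoly p x
      ≡⟨ solve 2 (λ x e → (con 0ℚ :+ x :* e) :+ con (- 1ℚ) :* e := (x :+ con (- 1ℚ)) :* e) refl x (evalPoly p x) ⟩
    (x + - 1ℚ) * evalPoly p x                   ∎

  length-[x-1]* : ∀ p → length ([x-1]* p) ≤ suc (length p)
  length-[x-1]* p = length-+ₚ (0ℚ ∷ p) ((- 1ℚ) ·ₚ p) (suc (length p)) ℕ.≤-refl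
    (subst (_≤ suc (length p)) (sym (length-map (- 1ℚ *_) p)) (ℕ.n≤1+n _))

  -- Synthetic division by (x - a): quotient and remainder.
  divide : ℚ → List ℚ → List ℚ × ℚ
  divide a []           = [] , 0ℚ
  divide a (c ∷ [])     = [] , c
  divide a (c ∷ c′ ∷ cs) = let q , r = divide a (c′ ∷ cs) in (r ∷ q) , c + a * r

  eval-divide : ∀ a p x → evalPoly p x ≡ (x + - a) * evalPoly (proj₁ (divide a p)) x + proj₂ (divide a p)
  eval-divide a []            x = solve 2 (λ x a → con 0ℚ := (x :+ :- a) :* con 0ℚ :+ con 0ℚ) refl x a
  eval-divide a (c ∷ [])      x = solve 3 (λ x a c → c :+ x :* con 0ℚ := (x :+ :- a) :* con 0ℚ :+ c) refl x a c
  eval-divide a (c ∷ c′ ∷ cs) x rewrite eval-divide a (c′ ∷ cs) x =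
    solve 5 (λ x a c q r → c :+ x :* ((x :+ :- a) :* q :+ r) := (x :+ :- a) :* (r :+ x :* q) :+ (c :+ a :* r)) refl
      x a c (evalPoly (proj₁ (divide a (c′ ∷ cs))) x) (proj₂ (divide a (c′ ∷ cs)))

  length-divide : ∀ a p → length (proj₁ (divide a p)) ≡ length p ∸ 1
  length-divide a []            = refl
  length-divide a (c ∷ [])      = refl
  length-divide a (c ∷ c′ ∷ cs) = cong suc (length-divide a (c′ ∷ cs))

  coeff≡0-of-divide : ∀ a p → (∀ m → coeff (proj₁ (divide a p)) m ≡ 0ℚ) → proj₂ (divide a p) ≡ 0ℚ →
                      ∀ m → coeff p m ≡ 0ℚ
  coeff≡0-of-divide a []            q≡0 r≡0 m       = refl
  coeff≡0-of-divide a (c ∷ [])      q≡0 r≡0 zero    = r≡0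
  coeff≡0-of-divide a (c ∷ [])      q≡0 r≡0 (suc m) = refl
  coeff≡0-of-divide a (c ∷ c′ ∷ cs) q≡0 r≡0 zero    = begin
    c                                            ≡⟨ ℚ.+-identityʳ c ⟨
    c + 0ℚ                                       ≡⟨ cong (c +_) (ℚ.*-zeroʳ a) ⟨
    c + a * 0ℚ                                   ≡⟨ cong (λ r → c + a * r) (q≡0 0) ⟨
    c + a * proj₂ (divide a (c′ ∷ cs))           ≡⟨ r≡0 ⟩
    0ℚ                                           ∎
  coeff≡0-of-divide a (c ∷ c′ ∷ cs) q≡0 r≡0 (suc m) = coeff≡0-of-divide a (c′ ∷ cs) (q≡0 ∘ suc) (q≡0 0) m

  -- Dividing by (x - (s + 1)) leaves a quotient that vanishes at all integers > s + 1.
  vanishing⇒coeff≡0 : ∀ ℓ s p → length p ≡ ℓ → (∀ j → evalPoly p (ℕ→ℚ (s ℕ.+ suc j)) ≡ 0ℚ) →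
                      ∀ m → coeff p m ≡ 0ℚ
  vanishing⇒coeff≡0 zero    s [] _      _         m = refl
  vanishing⇒coeff≡0 (suc ℓ) s p  |p|≡1+ℓ vanishes = coeff≡0-of-divide a p q≡0 r≡0
    where
    a = ℕ→ℚ (s ℕ.+ 1)
    q = proj₁ (divide a p)
    r = proj₂ (divide a p)
    r≡0 : r ≡ 0ℚ
    r≡0 = begin
      r                            ≡⟨ ℚ.+-identityˡ r ⟨
      0ℚ + r                       ≡⟨ cong (_+ r) (trans (cong (_* evalPoly q a) (ℚ.+-inverseʳ a))
                                                             (ℚ.*-zeroˡ (evalPoly q a))) ⟨
      (a + - a) * evalPoly q a + r ≡⟨ eval-divide a p a ⟨
      evalPoly p a                 ≡⟨ vanishes 0 ⟩
      0ℚ                           ∎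
    q-vanishes : ∀ j → evalPoly q (ℕ→ℚ (suc s ℕ.+ suc j)) ≡ 0ℚ
    q-vanishes j = ℕ→ℚ-suc-cancelˡ j (evalPoly q x) (begin
        ℕ→ℚ (suc j) * evalPoly q x      ≡⟨ cong (_* evalPoly q x) x-a≡1+j ⟨
        (x + - a) * evalPoly q x        ≡⟨ ℚ.+-identityʳ _ ⟨
        (x + - a) * evalPoly q x + 0ℚ   ≡⟨ cong ((x + - a) * evalPoly q x +_) r≡0 ⟨
        (x + - a) * evalPoly q x + r    ≡⟨ eval-divide a p x ⟨
        evalPoly p x                    ≡⟨ cong (evalPoly p ∘ ℕ→ℚ) (ℕ.+-suc s (suc j)) ⟨
        evalPoly p (ℕ→ℚ (s ℕ.+ suc (suc j))) ≡⟨ vanishes (suc j) ⟩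
        0ℚ                              ∎)
      where
      x = ℕ→ℚ (suc s ℕ.+ suc j)
      x≡a+1+j : x ≡ a + ℕ→ℚ (suc j)
      x≡a+1+j = trans (cong ℕ→ℚ (sym (trans (ℕ.+-assoc s 1 (suc j)) (ℕ.+-suc s (suc j))))) (ℕ→ℚ-+ (s ℕ.+ 1) (suc j))
      x-a≡1+j : x + - a ≡ ℕ→ℚ (suc j)
      x-a≡1+j = trans (cong (_+ - a) x≡a+1+j) (solve 2 (λ a u → (a :+ u) :+ :- a := u) refl a (ℕ→ℚ (suc j)))
    q≡0 : ∀ m → coeff q m ≡ 0ℚ
    q≡0 = vanishing⇒coeff≡0 ℓ (suc s) q (trans (length-divide a p) (cong (_∸ 1) |p|≡1+ℓ)) q-vanishes

  agreeOnℕ⁺⇒≈ₚ : ∀ p q → (∀ M → evalPoly p (ℕ→ℚ (suc M)) ≡ evalPoly q (ℕ→ℚ (suc M))) → p ≈ₚ q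
  agreeOnℕ⁺⇒≈ₚ p q p≡q m = begin
    coeff p m                                  ≡⟨ solve 2 (λ a b → a := (a :+ con (- 1ℚ) :* b) :+ b) refl (coeff p m) (coeff q m) ⟩
    (coeff p m + (- 1ℚ) * coeff q m) + coeff q m ≡⟨ cong (_+ coeff q m) difference≡0 ⟩
    0ℚ + coeff q m                             ≡⟨ ℚ.+-identityˡ _ ⟩
    coeff q m                                  ∎
    where
    difference = p +ₚ (- 1ℚ) ·ₚ q
    vanishes : ∀ j → evalPoly difference (ℕ→ℚ (0 ℕ.+ suc j)) ≡ 0ℚ
    vanishes j = begin
      evalPoly difference x                 ≡⟨ eval-+ₚ p ((- 1ℚ) ·ₚ q) x ⟩
      evalPoly p x + evalPoly ((- 1ℚ) ·ₚ q) x ≡⟨ cong₂ _+_ (p≡q j) (eval-·ₚ (- 1ℚ) q x) ⟩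
      evalPoly q x + (- 1ℚ) * evalPoly q x  ≡⟨ solve 1 (λ e → e :+ con (- 1ℚ) :* e := con 0ℚ) refl (evalPoly q x) ⟩
      0ℚ                                    ∎
      where x = ℕ→ℚ (suc j)
    difference≡0 : coeff p m + (- 1ℚ) * coeff q m ≡ 0ℚ
    difference≡0 = begin
      coeff p m + (- 1ℚ) * coeff q m           ≡⟨ cong (coeff p m +_) (coeff-·ₚ (- 1ℚ) q m) ⟨
      coeff p m + coeff ((- 1ℚ) ·ₚ q) m        ≡⟨ coeff-+ₚ p ((- 1ℚ) ·ₚ q) m ⟨
      coeff difference m                       ≡⟨ vanishing⇒coeff≡0 _ 0 difference refl vanishes m ⟩
      0ℚ                                       ∎

  -- The tree transform

  ∑₀ : ℕ → (ℕ → ℚ) → ℚ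
  ∑₀ zero    f = f 0
  ∑₀ (suc k) f = f 0 + ∑₀ k (f ∘ suc)

  syntax ∑₀ k (λ m → e) = ∑[ m ≤ k ] e

  ∑₀-cong : ∀ k {f g : ℕ → ℚ} → (∀ m → f m ≡ g m) → ∑₀ k f ≡ ∑₀ k g
  ∑₀-cong zero    f≗g = f≗g 0
  ∑₀-cong (suc k) f≗g = cong₂ _+_ (f≗g 0) (∑₀-cong k (f≗g ∘ suc))

  ∑₀-cong≤ : ∀ k {f g : ℕ → ℚ} → (∀ m → m ≤ k → f m ≡ g m) → ∑₀ k f ≡ ∑₀ k g
  ∑₀-cong≤ zero    f≗g = f≗g 0 z≤n
  ∑₀-cong≤ (suc k) f≗g = cong₂ _+_ (f≗g 0 z≤n) (∑₀-cong≤ k (λ m m≤k → f≗g (suc m) (s≤s m≤k)))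

  ∑₀-zero : ∀ k → ∑[ _ ≤ k ] 0ℚ ≡ 0ℚ
  ∑₀-zero zero    = refl
  ∑₀-zero (suc k) = cong (0ℚ +_) (∑₀-zero k)

  ∑₀-+ : ∀ k (f g : ℕ → ℚ) → ∑[ m ≤ k ] (f m + g m) ≡ ∑₀ k f + ∑₀ k g
  ∑₀-+ zero    f g = refl
  ∑₀-+ (suc k) f g rewrite ∑₀-+ k (f ∘ suc) (g ∘ suc) =
    solve 4 (λ a b c d → (a :+ b) :+ (c :+ d) := (a :+ c) :+ (b :+ d)) refl (f 0) (g 0) (∑₀ k (f ∘ suc)) (∑₀ k (g ∘ suc))

  ∑₀-*ˡ : ∀ k a (f : ℕ → ℚ) → ∑[ m ≤ k ] (a * f m) ≡ a * ∑₀ k f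
  ∑₀-*ˡ zero    a f = refl
  ∑₀-*ˡ (suc k) a f rewrite ∑₀-*ˡ k a (f ∘ suc) = sym (ℚ.*-distribˡ-+ a (f 0) (∑₀ k (f ∘ suc)))

  ∑₀-*ʳ : ∀ k a (f : ℕ → ℚ) → ∑[ m ≤ k ] (f m * a) ≡ ∑₀ k f * a
  ∑₀-*ʳ k a f = trans (∑₀-cong k (λ m → ℚ.*-comm (f m) a)) (trans (∑₀-*ˡ k a f) (ℚ.*-comm a _))

  ∑₀-∑ : ∀ k (xs : List B) (g : B → ℕ → ℚ) → ∑[ m ≤ k ] ∑[ x ∈ xs ] g x m ≡ ∑[ x ∈ xs ] ∑₀ k (g x)
  ∑₀-∑ zero    xs g = refl
  ∑₀-∑ (suc k) xs g rewrite ∑₀-∑ k xs (λ x → g x ∘ suc) = sym (∑-+ xs (λ x → g x 0) (λ x → ∑₀ k (g x ∘ suc)))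

  ∑₀-suc : ∀ k (f : ℕ → ℚ) → ∑₀ (suc k) f ≡ ∑₀ k f + f (suc k)
  ∑₀-suc zero    f = refl
  ∑₀-suc (suc k) f = trans (cong (f 0 +_) (∑₀-suc k (f ∘ suc))) (sym (ℚ.+-assoc (f 0) _ _))

  ∑₀≡head+sumFrom1 : ∀ k (f : ℕ → ℚ) → ∑₀ k f ≡ f 0 + sumFrom1 k f
  ∑₀≡head+sumFrom1 zero    f = sym (ℚ.+-identityʳ (f 0))
  ∑₀≡head+sumFrom1 (suc k) f = begin
    ∑₀ (suc k) f                      ≡⟨ ∑₀-suc k f ⟩
    ∑₀ k f + f (suc k)                ≡⟨ cong (_+ f (suc k)) (∑₀≡head+sumFrom1 k f) ⟩
    (f 0 + sumFrom1 k f) + f (suc k)  ≡⟨ ℚ.+-assoc (f 0) _ _ ⟩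
    f 0 + sumFrom1 (suc k) f          ∎

  sumFrom1-*ˡ : ∀ k a (f : ℕ → ℚ) → sumFrom1 k (λ m → a * f m) ≡ a * sumFrom1 k f
  sumFrom1-*ˡ zero    a f = sym (ℚ.*-zeroʳ a)
  sumFrom1-*ˡ (suc k) a f = trans (cong (_+ a * f (suc k)) (sumFrom1-*ˡ k a f)) (sym (ℚ.*-distribˡ-+ a _ _))

  [x-1]^_ : ℕ → List ℚ
  [x-1]^ zero  = 1ℚ ∷ []
  [x-1]^ suc j = [x-1]* ([x-1]^ j)

  -- treeTransform d p = Σₘ pₘ xᵐ (x - 1)^(d ∸ m), i.e. (x - 1)ᵈ p(x / (x - 1)) when deg p ≤ d.
  treeTransform : ℕ → List ℚ → List ℚ
  treeTransform d []       = []
  treeTransform d (c ∷ cs) = c ·ₚ [x-1]^ d +ₚ (0ℚ ∷ treeTransform (d ∸ 1) cs)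

  transformCoeff : ℕ → List ℚ → ℕ → ℚ
  transformCoeff d p k = ∑[ m ≤ k ] (coeff p m * coeff ([x-1]^ (d ∸ m)) (k ∸ m))

  coeff-treeTransform-∷ : ∀ d c cs k →
    coeff (treeTransform d (c ∷ cs)) k ≡ c * coeff ([x-1]^ d) k + coeff (0ℚ ∷ treeTransform (d ∸ 1) cs) k
  coeff-treeTransform-∷ d c cs k =
    trans (coeff-+ₚ (c ·ₚ [x-1]^ d) (0ℚ ∷ treeTransform (d ∸ 1) cs) k)
          (cong (_+ coeff (0ℚ ∷ treeTransform (d ∸ 1) cs) k) (coeff-·ₚ c ([x-1]^ d) k))

  coeff-treeTransform : ∀ d p k → coeff (treeTransform d p) k ≡ transformCoeff d p k
  coeff-treeTransform d []       k       =
    sym (trans (∑₀-cong k (λ m → ℚ.*-zeroˡ (coeff ([x-1]^ (d ∸ m)) (k ∸ m)))) (∑₀-zero k))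
  coeff-treeTransform d (c ∷ cs) zero    = trans (coeff-treeTransform-∷ d c cs 0) (ℚ.+-identityʳ _)
  coeff-treeTransform d (c ∷ cs) (suc k) = trans (coeff-treeTransform-∷ d c cs (suc k))
    (cong (c * coeff ([x-1]^ d) (suc k) +_) (trans (coeff-treeTransform (d ∸ 1) cs k)
      (∑₀-cong k (λ m → cong (λ e → coeff cs m * coeff ([x-1]^ e) (k ∸ m)) (ℕ.∸-+-assoc d 1 m)))))

  transformCoeff-cong : ∀ d p q → p ≈ₚ q → ∀ k → transformCoeff d p k ≡ transformCoeff d q k
  transformCoeff-cong d p q p≈q k = ∑₀-cong k (λ m → cong (_* coeff ([x-1]^ (d ∸ m)) (k ∸ m)) (p≈q m))

  transformCoeff-+ₚ : ∀ d p q k → transformCoeff d (p +ₚ q) k ≡ transformCoeff d p k + transformCoeff d q k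
  transformCoeff-+ₚ d p q k = trans
    (∑₀-cong k (λ m → trans (cong (_* w m) (coeff-+ₚ p q m)) (ℚ.*-distribʳ-+ (w m) (coeff p m) (coeff q m))))
    (∑₀-+ k _ _)
    where
    w : ℕ → ℚ
    w m = coeff ([x-1]^ (d ∸ m)) (k ∸ m)

  transformCoeff-·ₚ : ∀ d a p k → transformCoeff d (a ·ₚ p) k ≡ a * transformCoeff d p k
  transformCoeff-·ₚ d a p k = trans (∑₀-cong k (λ m → trans (cong (_* w m) (coeff-·ₚ a p m)) (ℚ.*-assoc a _ (w m))))
                                    (∑₀-*ˡ k a _)
    where
    w : ℕ → ℚ
    w m = coeff ([x-1]^ (d ∸ m)) (k ∸ m)

  transformCoeff-∑ₚ : ∀ d (xs : List B) (f : B → List ℚ) k →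
                      transformCoeff d (∑ₚ xs f) k ≡ ∑[ x ∈ xs ] transformCoeff d (f x) k
  transformCoeff-∑ₚ d xs f k = begin
    transformCoeff d (∑ₚ xs f) k
      ≡⟨ ∑₀-cong k (λ m → trans (cong (_* w m) (coeff-∑ₚ xs f m)) (sym (∑-*ʳ xs (w m) _))) ⟩
    ∑[ m ≤ k ] ∑[ x ∈ xs ] (coeff (f x) m * w m)
      ≡⟨ ∑₀-∑ k xs (λ x m → coeff (f x) m * w m) ⟩
    ∑[ x ∈ xs ] transformCoeff d (f x) k
      ∎
    where
    w : ℕ → ℚ
    w m = coeff ([x-1]^ (d ∸ m)) (k ∸ m)

  treeTransform-x* : ∀ d p → treeTransform d (0ℚ ∷ p) ≈ₚ 0ℚ ∷ treeTransform (d ∸ 1) p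
  treeTransform-x* d p k =
    trans (coeff-treeTransform-∷ d 0ℚ p k)
      (trans (cong (_+ coeff (0ℚ ∷ treeTransform (d ∸ 1) p) k) (ℚ.*-zeroˡ (coeff ([x-1]^ d) k))) (ℚ.+-identityˡ _))

  [x-1]*ᶜ-linear : ∀ c (g h : ℕ → ℚ) k → [x-1]*ᶜ (λ m → c * g m + h m) k ≡ c * [x-1]*ᶜ g k + [x-1]*ᶜ h k
  [x-1]*ᶜ-linear c g h zero = solve 3 (λ c g h → con 0ℚ :+ con (- 1ℚ) :* (c :* g :+ h)
      := c :* (con 0ℚ :+ con (- 1ℚ) :* g) :+ (con 0ℚ :+ con (- 1ℚ) :* h)) refl c (g 0) (h 0)
  [x-1]*ᶜ-linear c g h (suc k) = solve 5 (λ c g h g′ h′ → (c :* g :+ h) :+ con (- 1ℚ) :* (c :* g′ :+ h′)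
      := c :* (g :+ con (- 1ℚ) :* g′) :+ (h :+ con (- 1ℚ) :* h′)) refl c (g k) (h k) (g (suc k)) (h (suc k))

  [x-1]*ᶜ-cong : ∀ {f g : ℕ → ℚ} → (∀ m → f m ≡ g m) → ∀ k → [x-1]*ᶜ f k ≡ [x-1]*ᶜ g k
  [x-1]*ᶜ-cong f≗g zero    = cong (λ e → 0ℚ + (- 1ℚ) * e) (f≗g 0)
  [x-1]*ᶜ-cong f≗g (suc k) = cong₂ (λ e e′ → e + (- 1ℚ) * e′) (f≗g k) (f≗g (suc k))

  treeTransform-suc : ∀ d p → length p ≤ suc d → ∀ k →
                      coeff (treeTransform (suc d) p) k ≡ [x-1]*ᶜ (coeff (treeTransform d p)) k
  treeTransform-suc d []       _         zero    = refl
  treeTransform-suc d []       _         (suc k) = refl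
  treeTransform-suc d (c ∷ cs) (s≤s cs≤d) k = begin
    coeff (treeTransform (suc d) (c ∷ cs)) k
      ≡⟨ coeff-treeTransform-∷ (suc d) c cs k ⟩
    c * coeff ([x-1]* ([x-1]^ d)) k + coeff (0ℚ ∷ treeTransform d cs) k
      ≡⟨ cong₂ (λ e e′ → c * e + e′) (coeff-[x-1]* ([x-1]^ d) k) (shifted d cs cs≤d k) ⟩
    c * [x-1]*ᶜ (coeff ([x-1]^ d)) k + [x-1]*ᶜ (coeff (0ℚ ∷ treeTransform (d ∸ 1) cs)) k
      ≡⟨ [x-1]*ᶜ-linear c (coeff ([x-1]^ d)) (coeff (0ℚ ∷ treeTransform (d ∸ 1) cs)) k ⟨
    [x-1]*ᶜ (λ m → c * coeff ([x-1]^ d) m + coeff (0ℚ ∷ treeTransform (d ∸ 1) cs) m) k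
      ≡⟨ [x-1]*ᶜ-cong (λ m → sym (coeff-treeTransform-∷ d c cs m)) k ⟩
    [x-1]*ᶜ (coeff (treeTransform d (c ∷ cs))) k
      ∎
    where
    shifted : ∀ d cs → length cs ≤ d → ∀ k →
              coeff (0ℚ ∷ treeTransform d cs) k ≡ [x-1]*ᶜ (coeff (0ℚ ∷ treeTransform (d ∸ 1) cs)) k
    shifted d       cs _    zero          = refl
    shifted zero    [] _    (suc zero)    = refl
    shifted zero    [] _    (suc (suc k)) = refl
    shifted (suc d) cs cs≤d (suc k)       =
      trans (treeTransform-suc d cs cs≤d k) (sym ([x-1]*ᶜ-shift (treeTransform d cs) k))
      where
      [x-1]*ᶜ-shift : ∀ (p : List ℚ) k → coeff (0ℚ ∷ p) k + (- 1ℚ) * coeff p k ≡ [x-1]*ᶜ (coeff p) k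
      [x-1]*ᶜ-shift p zero    = refl
      [x-1]*ᶜ-shift p (suc k) = refl

  treeTransform-[x-1]* : ∀ d p → length p ≤ suc d → treeTransform (suc d) ([x-1]* p) ≈ₚ treeTransform d p
  treeTransform-[x-1]* d p p≤1+d k = begin
    coeff (treeTransform (suc d) ([x-1]* p)) k
      ≡⟨ coeff-treeTransform (suc d) ([x-1]* p) k ⟩
    transformCoeff (suc d) ((0ℚ ∷ p) +ₚ (- 1ℚ) ·ₚ p) k
      ≡⟨ transformCoeff-+ₚ (suc d) (0ℚ ∷ p) ((- 1ℚ) ·ₚ p) k ⟩
    transformCoeff (suc d) (0ℚ ∷ p) k + transformCoeff (suc d) ((- 1ℚ) ·ₚ p) k
      ≡⟨ cong₂ _+_ (trans (sym (coeff-treeTransform (suc d) (0ℚ ∷ p) k)) (treeTransform-x* (suc d) p k))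
                   (trans (transformCoeff-·ₚ (suc d) (- 1ℚ) p k)
                          (cong ((- 1ℚ) *_) (trans (sym (coeff-treeTransform (suc d) p k)) (treeTransform-suc d p p≤1+d k)))) ⟩
    coeff (0ℚ ∷ treeTransform d p) k + (- 1ℚ) * [x-1]*ᶜ (coeff (treeTransform d p)) k
      ≡⟨ cancel k ⟩
    coeff (treeTransform d p) k
      ∎
    where
    cancel : ∀ k → coeff (0ℚ ∷ treeTransform d p) k + (- 1ℚ) * [x-1]*ᶜ (coeff (treeTransform d p)) k
                   ≡ coeff (treeTransform d p) k
    cancel zero    = solve 1 (λ t → con 0ℚ :+ con (- 1ℚ) :* (con 0ℚ :+ con (- 1ℚ) :* t) := t) refl
                       (coeff (treeTransform d p) 0)
    cancel (suc k) = solve 2 (λ t t′ → t :+ con (- 1ℚ) :* (t :+ con (- 1ℚ) :* t′) := t′) refl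
                       (coeff (treeTransform d p) k) (coeff (treeTransform d p) (suc k))

  coeff-[x-1]^ : ∀ j i → coeff ([x-1]^ j) i ≡ signℚ (j ℕ.+ i) * ℕ→ℚ (j C i)
  coeff-[x-1]^ zero    zero    = refl
  coeff-[x-1]^ zero    (suc i) = sym (ℚ.*-zeroʳ (signℚ (suc i)))
  coeff-[x-1]^ (suc j) zero    = begin
    coeff ([x-1]^ suc j) 0                    ≡⟨ coeff-[x-1]* ([x-1]^ j) 0 ⟩
    0ℚ + (- 1ℚ) * coeff ([x-1]^ j) 0          ≡⟨ cong (λ e → 0ℚ + (- 1ℚ) * e) (coeff-[x-1]^ j 0) ⟩
    0ℚ + (- 1ℚ) * (signℚ (j ℕ.+ 0) * 1ℚ)
      ≡⟨ solve 1 (λ σ → con 0ℚ :+ con (- 1ℚ) :* (σ :* con 1ℚ) := (:- σ) :* con 1ℚ) refl (signℚ (j ℕ.+ 0)) ⟩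
    signℚ (suc j ℕ.+ 0) * 1ℚ                  ∎
  coeff-[x-1]^ (suc j) (suc i) = begin
    coeff ([x-1]* ([x-1]^ j)) (suc i)
      ≡⟨ coeff-[x-1]* ([x-1]^ j) (suc i) ⟩
    coeff ([x-1]^ j) i + (- 1ℚ) * coeff ([x-1]^ j) (suc i)
      ≡⟨ cong₂ (λ e e′ → e + (- 1ℚ) * e′) (coeff-[x-1]^ j i)
               (trans (coeff-[x-1]^ j (suc i)) (cong (λ e → signℚ e * ℕ→ℚ (j C suc i)) (ℕ.+-suc j i))) ⟩
    σ * ℕ→ℚ (j C i) + (- 1ℚ) * ((- σ) * ℕ→ℚ (j C suc i))
      ≡⟨ solve 3 (λ σ a b → σ :* a :+ con (- 1ℚ) :* ((:- σ) :* b) := (:- (:- σ)) :* (a :+ b)) refl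
           σ (ℕ→ℚ (j C i)) (ℕ→ℚ (j C suc i)) ⟩
    (- (- σ)) * (ℕ→ℚ (j C i) + ℕ→ℚ (j C suc i))
      ≡⟨ cong₂ _*_ (cong (λ e → - signℚ e) (sym (ℕ.+-suc j i)))
                   (trans (sym (ℕ→ℚ-+ (j C i) (j C suc i))) (cong ℕ→ℚ (nCk+nC[k+1]≡[n+1]C[k+1] j i))) ⟩
    signℚ (suc j ℕ.+ suc i) * ℕ→ℚ (suc j C suc i)
      ∎
    where
    σ = signℚ (j ℕ.+ i)

  x^_ : ℕ → List ℚ
  x^ zero  = 1ℚ ∷ []
  x^ suc n = 0ℚ ∷ x^ n

  coeff-x^ : ∀ n k → coeff (x^ n) k ≡ (if n ≡ᵇ k then 1ℚ else 0ℚ)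
  coeff-x^ zero    zero    = refl
  coeff-x^ zero    (suc k) = refl
  coeff-x^ (suc n) zero    = refl
  coeff-x^ (suc n) (suc k) = coeff-x^ n k

  -- Chromatic polynomials of path forests

  -- The chromatic polynomial of P_a times q (compare χ-block).
  blockPoly : ℕ → List ℚ → List ℚ
  blockPoly zero          q = q
  blockPoly (suc zero)    q = 0ℚ ∷ q
  blockPoly (suc (suc a)) q = [x-1]* blockPoly (suc a) q

  pathsPoly : List ℕ → List ℚ
  pathsPoly []      = 1ℚ ∷ []
  pathsPoly (a ∷ r) = blockPoly a (pathsPoly r)

  length-blockPoly : ∀ a q → length (blockPoly a q) ≤ a ℕ.+ length q
  length-blockPoly zero          q = ℕ.≤-refl
  length-blockPoly (suc zero)    q = ℕ.≤-refl
  length-blockPoly (suc (suc a)) q = ℕ.≤-trans (length-[x-1]* (blockPoly (suc a) q)) (s≤s (length-blockPoly (suc a) q))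

  length-pathsPoly : ∀ λs → length (pathsPoly λs) ≤ suc (sum λs)
  length-pathsPoly []      = ℕ.≤-refl
  length-pathsPoly (a ∷ r) = ℕ.≤-trans (length-blockPoly a (pathsPoly r))
    (ℕ.≤-trans (ℕ.+-monoʳ-≤ a (length-pathsPoly r)) (ℕ.≤-reflexive (ℕ.+-suc a (sum r))))

  eval-blockPoly : ∀ M a q v → evalPoly q (ℕ→ℚ (suc M)) ≡ ℕ→ℚ v →
                   evalPoly (blockPoly a q) (ℕ→ℚ (suc M)) ≡ ℕ→ℚ (χ-block (suc M) a v)
  eval-blockPoly M zero          q v q≡v = q≡v
  eval-blockPoly M (suc zero)    q v q≡v =
    trans (ℚ.+-identityˡ _) (trans (cong (ℕ→ℚ (suc M) *_) q≡v) (sym (ℕ→ℚ-* (suc M) v)))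
  eval-blockPoly M (suc (suc a)) q v q≡v = begin
    evalPoly ([x-1]* blockPoly (suc a) q) x          ≡⟨ eval-[x-1]* (blockPoly (suc a) q) x ⟩
    (x + - 1ℚ) * evalPoly (blockPoly (suc a) q) x    ≡⟨ cong₂ _*_ x-1≡M (eval-blockPoly M (suc a) q v q≡v) ⟩
    ℕ→ℚ M * ℕ→ℚ (χ-block (suc M) (suc a) v)          ≡⟨ ℕ→ℚ-* M _ ⟨
    ℕ→ℚ (χ-block (suc M) (suc (suc a)) v)            ∎
    where
    x = ℕ→ℚ (suc M)
    x-1≡M : x + - 1ℚ ≡ ℕ→ℚ M
    x-1≡M = trans (cong (_+ - 1ℚ) (ℕ→ℚ-+ 1 M)) (solve 1 (λ m → (con 1ℚ :+ m) :+ :- con 1ℚ := m) refl (ℕ→ℚ M))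

  eval-pathsPoly : ∀ M λs → evalPoly (pathsPoly λs) (ℕ→ℚ (suc M)) ≡ ℕ→ℚ (χ-paths (suc M) λs)
  eval-pathsPoly M []      = trans (cong (1ℚ +_) (ℚ.*-zeroʳ (ℕ→ℚ (suc M)))) (ℚ.+-identityʳ 1ℚ)
  eval-pathsPoly M (a ∷ r) = eval-blockPoly M a (pathsPoly r) (χ-paths (suc M) r) (eval-pathsPoly M r)

  treeTransform-blockPoly : ∀ a r →
    treeTransform (suc a ℕ.+ sum r) (blockPoly (suc a) (pathsPoly r)) ≈ₚ 0ℚ ∷ treeTransform (sum r) (pathsPoly r)
  treeTransform-blockPoly zero    r = treeTransform-x* (suc (sum r)) (pathsPoly r)
  treeTransform-blockPoly (suc a) r k =
    trans (treeTransform-[x-1]* (suc a ℕ.+ sum r) (blockPoly (suc a) (pathsPoly r)) degree k) (treeTransform-blockPoly a r k)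
    where
    degree : length (blockPoly (suc a) (pathsPoly r)) ≤ suc (suc a ℕ.+ sum r)
    degree = ℕ.≤-trans (length-blockPoly (suc a) (pathsPoly r))
      (ℕ.≤-trans (ℕ.+-monoʳ-≤ (suc a) (length-pathsPoly r)) (ℕ.≤-reflexive (ℕ.+-suc (suc a) (sum r))))

  -- Each factor x (x - 1)^(a - 1) of χ_{P_λ} becomes a factor x.
  treeTransform-pathsPoly : ∀ λs → All (0 ℕ.<_) λs → treeTransform (sum λs) (pathsPoly λs) ≈ₚ x^ length λs
  treeTransform-pathsPoly []            _           zero    = refl
  treeTransform-pathsPoly []            _           (suc k) = refl
  treeTransform-pathsPoly (suc a ∷ r)   (_ ∷ r>0) k = trans (treeTransform-blockPoly a r k) (shifted k)
    where
    shifted : 0ℚ ∷ treeTransform (sum r) (pathsPoly r) ≈ₚ x^ length (suc a ∷ r)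
    shifted zero    = refl
    shifted (suc k) = treeTransform-pathsPoly r r>0 k

  -- The coefficient formula

  δ : ℕ → ℕ → ℚ
  δ s d = ℕ→ℚ (𝟙 (s ≡ᵇ d))

  ∑₀-δ : ∀ D s → s ≤ D → ∑[ d ≤ D ] δ s d ≡ 1ℚ
  ∑₀-δ zero    zero    _         = refl
  ∑₀-δ (suc D) zero    _         = cong (1ℚ +_) (∑₀-zero D)
  ∑₀-δ (suc D) (suc s) (s≤s s≤D) = trans (ℚ.+-identityˡ _) (∑₀-δ D s s≤D)

  δ-subst : ∀ s d (F : ℕ → ℚ) → δ s d * F s ≡ δ s d * F d
  δ-subst s d F with s ≡ᵇ d in s≡ᵇd
  ... | true  = cong (λ e → 1ℚ * F e) (ℕ.≡ᵇ⇒≡ s d (Equivalence.from T-≡ s≡ᵇd))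
  ... | false = trans (ℚ.*-zeroˡ (F s)) (sym (ℚ.*-zeroˡ (F d)))

  δ-vanishing : ∀ s d (X : ℚ) → (s ≡ d → X ≡ 0ℚ) → δ s d * X ≡ 0ℚ
  δ-vanishing s d X X≡0 with s ≡ᵇ d in s≡ᵇd
  ... | true  = trans (ℚ.*-identityˡ X) (X≡0 (ℕ.≡ᵇ⇒≡ s d (Equivalence.from T-≡ s≡ᵇd)))
  ... | false = ℚ.*-zeroˡ X

  δ-refl : ∀ n → δ n n ≡ 1ℚ
  δ-refl n = cong (ℕ→ℚ ∘ 𝟙) (Equivalence.to T-≡ (ℕ.≡⇒≡ᵇ n n refl))

  if-then-1-else-0 : ∀ (b : Bool) (q : ℚ) → (if b then q else 0ℚ) ≡ q * (if b then 1ℚ else 0ℚ)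
  if-then-1-else-0 true  q = sym (ℚ.*-identityʳ q)
  if-then-1-else-0 false q = sym (ℚ.*-zeroʳ q)

  signℚ-+ : ∀ a b → signℚ (a ℕ.+ b) ≡ signℚ a * signℚ b
  signℚ-+ zero    b = sym (ℚ.*-identityˡ _)
  signℚ-+ (suc a) b = trans (cong -_ (signℚ-+ a b)) (ℚ.neg-distribˡ-* (signℚ a) (signℚ b))

  signℚ-square : ∀ m → signℚ m * signℚ m ≡ 1ℚ
  signℚ-square zero    = refl
  signℚ-square (suc m) = trans (solve 1 (λ σ → (:- σ) :* (:- σ) := σ :* σ) refl (signℚ m)) (signℚ-square m)

  signℚ-∸-∸ : ∀ n k m → m ≤ n → m ≤ k → signℚ ((n ∸ m) ℕ.+ (k ∸ m)) ≡ signℚ (n ℕ.+ k)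
  signℚ-∸-∸ n k m m≤n m≤k = begin
    signℚ ((n ∸ m) ℕ.+ (k ∸ m))  ≡⟨ signℚ-+ (n ∸ m) (k ∸ m) ⟩
    a * b                        ≡⟨ ℚ.*-identityʳ (a * b) ⟨
    (a * b) * 1ℚ                 ≡⟨ cong ((a * b) *_) (signℚ-square m) ⟨
    (a * b) * (σ * σ)            ≡⟨ solve 3 (λ a b σ → (a :* b) :* (σ :* σ) := (a :* σ) :* (b :* σ)) refl a b σ ⟩
    (a * σ) * (b * σ)            ≡⟨ cong₂ _*_ (signℚ-+ (n ∸ m) m) (signℚ-+ (k ∸ m) m) ⟨
    signℚ ((n ∸ m) ℕ.+ m) * signℚ ((k ∸ m) ℕ.+ m)
                                 ≡⟨ cong₂ (λ e e′ → signℚ e * signℚ e′) (ℕ.m∸n+n≡m m≤n) (ℕ.m∸n+n≡m m≤k) ⟩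
    signℚ n * signℚ k            ≡⟨ signℚ-+ n k ⟨
    signℚ (n ℕ.+ k)              ∎
    where
    a = signℚ (n ∸ m)
    b = signℚ (k ∸ m)
    σ = signℚ m

  transformCoeff-term : ∀ n k m (cₘ : ℚ) → m ≤ k → (n ℕ.< m → cₘ ≡ 0ℚ) →
    cₘ * coeff ([x-1]^ (n ∸ m)) (k ∸ m) ≡ signℚ (n ℕ.+ k) * (ℕ→ℚ ((n ∸ m) C (k ∸ m)) * cₘ)
  transformCoeff-term n k m cₘ m≤k cₘ≡0 with m ℕ.≤? n
  ... | yes m≤n = begin
    cₘ * coeff ([x-1]^ (n ∸ m)) (k ∸ m)
      ≡⟨ cong (cₘ *_) (coeff-[x-1]^ (n ∸ m) (k ∸ m)) ⟩
    cₘ * (signℚ ((n ∸ m) ℕ.+ (k ∸ m)) * binom)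
      ≡⟨ cong (λ σ → cₘ * (σ * binom)) (signℚ-∸-∸ n k m m≤n m≤k) ⟩
    cₘ * (signℚ (n ℕ.+ k) * binom)
      ≡⟨ solve 3 (λ c σ b → c :* (σ :* b) := σ :* (b :* c)) refl cₘ (signℚ (n ℕ.+ k)) binom ⟩
    signℚ (n ℕ.+ k) * (binom * cₘ)
      ∎
    where binom = ℕ→ℚ ((n ∸ m) C (k ∸ m))
  ... | no  m≰n rewrite cₘ≡0 (ℕ.≰⇒> m≰n) =
    trans (ℚ.*-zeroˡ (coeff ([x-1]^ (n ∸ m)) (k ∸ m)))
          (sym (trans (cong (signℚ (n ℕ.+ k) *_) (ℚ.*-zeroʳ (ℕ→ℚ ((n ∸ m) C (k ∸ m)))))
                      (ℚ.*-zeroʳ (signℚ (n ℕ.+ k)))))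

  -- The paper's sum starts at m = 1, which is why c₀ = 0 is needed.
  transformCoeff≡rhs : ∀ n c k → coeff c 0 ≡ 0ℚ → (∀ m → n ℕ.< m → coeff c m ≡ 0ℚ) →
                       transformCoeff n c k ≡ rhs n c k
  transformCoeff≡rhs n c k c₀≡0 c≡0-above-n = begin
    transformCoeff n c k      ≡⟨ ∑₀-cong≤ k (λ m m≤k → transformCoeff-term n k m (coeff c m) m≤k (c≡0-above-n m)) ⟩
    ∑₀ k term                 ≡⟨ ∑₀≡head+sumFrom1 k term ⟩
    term 0 + sumFrom1 k term  ≡⟨ cong₂ _+_ term₀≡0 (sumFrom1-*ˡ k (signℚ (n ℕ.+ k)) _) ⟩
    0ℚ + rhs n c k            ≡⟨ ℚ.+-identityˡ _ ⟩
    rhs n c k                 ∎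
    where
    term : ℕ → ℚ
    term m = signℚ (n ℕ.+ k) * (ℕ→ℚ ((n ∸ m) C (k ∸ m)) * coeff c m)
    term₀≡0 : term 0 ≡ 0ℚ
    term₀≡0 rewrite c₀≡0 =
      trans (cong (signℚ (n ℕ.+ k) *_) (ℚ.*-zeroʳ (ℕ→ℚ ((n ∸ 0) C (k ∸ 0))))) (ℚ.*-zeroʳ (signℚ (n ℕ.+ k)))

  module PathExpansion {n} (G : SimpleGraph n) (L : Combination) (expansion : IsPathExpansionOf G L)
                       (c : List ℚ) (chromatic : IsChromaticPoly G c) where

    shape : Partition × ℚ → List ℕ
    shape t = proj₁ (proj₁ t)

    weight : Partition × ℚ → ℚ
    weight t = proj₂ t

    size : Partition × ℚ → ℕ
    size t = sum (shape t)

    ℕ→ℚ-degreePart : ∀ {s} (a : Fin s → Fin s → Bool) N d →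
      ℕ→ℚ (degreePart a N d)
        ≡ ∑[ g ∈ allFuns N (suc d) ] (δ (ℕ-Sum.∑ (allFin N) (toℕ ∘ g)) d * ℕ→ℚ (xCoeff a N (toℕ ∘ g)))
    ℕ→ℚ-degreePart a N d = trans (ℕ→ℚ-∑ (allFuns N (suc d)) _) (∑-cong (allFuns N (suc d)) (λ g →
      ℕ→ℚ-* (𝟙 (ℕ-Sum.∑ (allFin N) (toℕ ∘ g) ≡ᵇ d)) (xCoeff a N (toℕ ∘ g))))

    degreePart-expansion : ∀ N d →
      ℕ→ℚ (degreePart (adj G) N d) ≡ ∑[ t ∈ L ] (weight t * ℕ→ℚ (degreePart (pathAdj (shape t)) N d))
    degreePart-expansion N d = begin
      ℕ→ℚ (degreePart (adj G) N d)
        ≡⟨ ℕ→ℚ-degreePart (adj G) N d ⟩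
      ∑[ g ∈ gs ] (w g * ℕ→ℚ (xCoeff (adj G) N (toℕ ∘ g)))
        ≡⟨ ∑-cong gs (λ g → cong (w g *_) (expansion N (toℕ ∘ g))) ⟩
      ∑[ g ∈ gs ] (w g * ∑[ t ∈ L ] (weight t * x t g))
        ≡⟨ ∑-*-∑-comm gs L w weight x ⟩
      ∑[ t ∈ L ] (weight t * ∑[ g ∈ gs ] (w g * x t g))
        ≡⟨ ∑-cong L (λ t → cong (weight t *_) (ℕ→ℚ-degreePart (pathAdj (shape t)) N d)) ⟨
      ∑[ t ∈ L ] (weight t * ℕ→ℚ (degreePart (pathAdj (shape t)) N d))
        ∎
      where
      gs = allFuns N (suc d)
      w : (Fin N → Fin (suc d)) → ℚ
      w g = δ (ℕ-Sum.∑ (allFin N) (toℕ ∘ g)) d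
      x : Partition × ℚ → (Fin N → Fin (suc d)) → ℚ
      x t g = ℕ→ℚ (xCoeff (pathAdj (shape t)) N (toℕ ∘ g))

    -- The degree-d part of the expansion: Σ_{|λ| = d} q_λ χ_{P_λ}.
    slice : ℕ → List ℚ
    slice d = ∑ₚ L (λ t → (weight t * δ (size t) d) ·ₚ pathsPoly (shape t))

    -- Both sides of the expansion have the same degree-d part, evaluated at M + 1 colours.
    eval-slice : ∀ d M → evalPoly (slice d) (ℕ→ℚ (suc M)) ≡ evalPoly (δ n d ·ₚ c) (ℕ→ℚ (suc M))
    eval-slice d M = begin
      evalPoly (slice d) x
        ≡⟨ trans (eval-∑ₚ L _ x) (∑-cong L (λ t → eval-·ₚ (weight t * δ (size t) d) (pathsPoly (shape t)) x)) ⟩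
      ∑[ t ∈ L ] ((weight t * δ (size t) d) * evalPoly (pathsPoly (shape t)) x)
        ≡⟨ ∑-cong L (λ t → cong ((weight t * δ (size t) d) *_) (count t)) ⟩
      ∑[ t ∈ L ] ((weight t * δ (size t) d) * ℕ→ℚ (numColourings (pathAdj (shape t)) (suc M)))
        ≡⟨ ∑-cong L (λ t → trans (ℚ.*-assoc (weight t) _ _) (cong (weight t *_) (degreePart-paths t))) ⟩
      ∑[ t ∈ L ] (weight t * ℕ→ℚ (degreePart (pathAdj (shape t)) (suc M) d))
        ≡⟨ degreePart-expansion (suc M) d ⟨
      ℕ→ℚ (degreePart (adj G) (suc M) d)
        ≡⟨ trans (cong ℕ→ℚ (degreePart≡ (adj G) (suc M) d)) (ℕ→ℚ-* (𝟙 (n ≡ᵇ d)) _) ⟩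
      δ n d * ℕ→ℚ (numColourings (adj G) (suc M))
        ≡⟨ cong (δ n d *_) (chromatic (suc M)) ⟨
      δ n d * evalPoly c x
        ≡⟨ eval-·ₚ (δ n d) c x ⟨
      evalPoly (δ n d ·ₚ c) x
        ∎
      where
      x = ℕ→ℚ (suc M)
      count : ∀ t → evalPoly (pathsPoly (shape t)) x ≡ ℕ→ℚ (numColourings (pathAdj (shape t)) (suc M))
      count t = trans (eval-pathsPoly M (shape t)) (cong ℕ→ℚ (sym (numColourings-pathAdj (suc M) (shape t))))
      degreePart-paths : ∀ t → δ (size t) d * ℕ→ℚ (numColourings (pathAdj (shape t)) (suc M))
                               ≡ ℕ→ℚ (degreePart (pathAdj (shape t)) (suc M) d)
      degreePart-paths t = trans (sym (ℕ→ℚ-* (𝟙 (size t ≡ᵇ d)) _))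
                                 (cong ℕ→ℚ (sym (degreePart≡ (pathAdj (shape t)) (suc M) d)))

    slice≈δ·c : ∀ d → slice d ≈ₚ δ n d ·ₚ c
    slice≈δ·c d = agreeOnℕ⁺⇒≈ₚ (slice d) (δ n d ·ₚ c) (eval-slice d)

    coeff-chromatic-above : ∀ m → n ℕ.< m → coeff c m ≡ 0ℚ
    coeff-chromatic-above m n<m = begin
      coeff c m                 ≡⟨ ℚ.*-identityˡ _ ⟨
      1ℚ * coeff c m            ≡⟨ cong (_* coeff c m) (δ-refl n) ⟨
      δ n n * coeff c m         ≡⟨ trans (slice≈δ·c n m) (coeff-·ₚ (δ n n) c m) ⟨
      coeff (slice n) m         ≡⟨ coeff-∑ₚ L _ m ⟩
      ∑[ t ∈ L ] coeff ((weight t * δ (size t) n) ·ₚ pathsPoly (shape t)) m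
                                ≡⟨ ∑-cong L (λ t → trans (coeff-·ₚ (weight t * δ (size t) n) (pathsPoly (shape t)) m)
                                                         (term≡0 t)) ⟩
      ∑[ _ ∈ L ] 0ℚ             ≡⟨ ∑-zero L ⟩
      0ℚ                        ∎
      where
      term≡0 : ∀ t → (weight t * δ (size t) n) * coeff (pathsPoly (shape t)) m ≡ 0ℚ
      term≡0 t = begin
        (weight t * δ (size t) n) * X    ≡⟨ ℚ.*-assoc (weight t) _ X ⟩
        weight t * (δ (size t) n * X)    ≡⟨ cong (weight t *_) (δ-vanishing (size t) n X X≡0) ⟩
        weight t * 0ℚ                    ≡⟨ ℚ.*-zeroʳ (weight t) ⟩
        0ℚ                               ∎
        where
        X = coeff (pathsPoly (shape t)) m
        X≡0 : size t ≡ n → X ≡ 0ℚ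
        X≡0 size≡n = coeff-beyond-length (pathsPoly (shape t)) m
          (ℕ.≤-trans (length-pathsPoly (shape t)) (subst (λ e → suc e ≤ m) (sym size≡n) n<m))

    weightedTransforms : ℕ → ℚ
    weightedTransforms k = ∑[ t ∈ L ] (weight t * transformCoeff (size t) (pathsPoly (shape t)) k)

    treeCoeff≡weightedTransforms : ∀ k → treeCoeff L k ≡ weightedTransforms k
    treeCoeff≡weightedTransforms k = ∑-cong L (λ t → begin
      (if length (shape t) ≡ᵇ k then weight t else 0ℚ)
        ≡⟨ if-then-1-else-0 (length (shape t) ≡ᵇ k) (weight t) ⟩
      weight t * (if length (shape t) ≡ᵇ k then 1ℚ else 0ℚ)
        ≡⟨ cong (weight t *_) (coeff-x^ (length (shape t)) k) ⟨
      weight t * coeff (x^ length (shape t)) k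
        ≡⟨ cong (weight t *_) (treeTransform-pathsPoly (shape t) (proj₁ (proj₂ (proj₁ t))) k) ⟨
      weight t * coeff (treeTransform (size t) (pathsPoly (shape t))) k
        ≡⟨ cong (weight t *_) (coeff-treeTransform (size t) (pathsPoly (shape t)) k) ⟩
      weight t * transformCoeff (size t) (pathsPoly (shape t)) k
        ∎)

    transformCoeff-slice : ∀ d k →
      transformCoeff d (slice d) k ≡ ∑[ t ∈ L ] (δ (size t) d * (weight t * transformCoeff d (pathsPoly (shape t)) k))
    transformCoeff-slice d k = trans (transformCoeff-∑ₚ d L _ k) (∑-cong L (λ t →
      trans (transformCoeff-·ₚ d (weight t * δ (size t) d) (pathsPoly (shape t)) k)
            (solve 3 (λ w δ T → (w :* δ) :* T := δ :* (w :* T)) refl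
                   (weight t) (δ (size t) d) (transformCoeff d (pathsPoly (shape t)) k))))

    -- Group the shapes by size d ≤ D, where D bounds n and every size.
    weightedTransforms≡transformCoeff : ∀ k → weightedTransforms k ≡ transformCoeff n c k
    weightedTransforms≡transformCoeff k = begin
      ∑[ t ∈ L ] term t (size t)
        ≡⟨ ∑-cong-All L (Colourings.≤-∑ L size) (λ t size≤ → trans (sym (ℚ.*-identityˡ _))
             (cong (_* term t (size t)) (sym (∑₀-δ D (size t) (ℕ.≤-trans size≤ (ℕ.m≤n+m _ n)))))) ⟩
      ∑[ t ∈ L ] (∑[ d ≤ D ] δ (size t) d * term t (size t))
        ≡⟨ ∑-cong L (λ t → trans (sym (∑₀-*ʳ D (term t (size t)) (δ (size t))))
                                 (∑₀-cong D (λ d → δ-subst (size t) d (term t)))) ⟩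
      ∑[ t ∈ L ] ∑[ d ≤ D ] (δ (size t) d * term t d)
        ≡⟨ ∑₀-∑ D L (λ t d → δ (size t) d * term t d) ⟨
      ∑[ d ≤ D ] ∑[ t ∈ L ] (δ (size t) d * term t d)
        ≡⟨ ∑₀-cong D (λ d → transformCoeff-slice d k) ⟨
      ∑[ d ≤ D ] transformCoeff d (slice d) k
        ≡⟨ ∑₀-cong D (λ d → trans (transformCoeff-cong d (slice d) (δ n d ·ₚ c) (slice≈δ·c d) k)
                                  (transformCoeff-·ₚ d (δ n d) c k)) ⟩
      ∑[ d ≤ D ] (δ n d * transformCoeff d c k)
        ≡⟨ ∑₀-cong D (λ d → δ-subst n d (λ e → transformCoeff e c k)) ⟨
      ∑[ d ≤ D ] (δ n d * transformCoeff n c k)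
        ≡⟨ ∑₀-*ʳ D (transformCoeff n c k) (δ n) ⟩
      (∑[ d ≤ D ] δ n d) * transformCoeff n c k
        ≡⟨ trans (cong (_* transformCoeff n c k) (∑₀-δ D n (ℕ.m≤m+n n _))) (ℚ.*-identityˡ _) ⟩
      transformCoeff n c k
        ∎
      where
      D = n ℕ.+ ℕ-Sum.∑ L size
      term : Partition × ℚ → ℕ → ℚ
      term t d = weight t * transformCoeff d (pathsPoly (shape t)) k

  coeff-chromatic-0 : ∀ {n} → 1 ≤ n → (G : SimpleGraph n) (c : List ℚ) → IsChromaticPoly G c → coeff c 0 ≡ 0ℚ
  coeff-chromatic-0 {suc _} _ G c chromatic = trans (sym (eval-0 c)) (chromatic 0)

open Polynomials

theorem3p2 : (n : ℕ) → 1 ≤ n → (G : SimpleGraph n)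
    → (L : Combination) → IsPathExpansionOf G L
    → (c : List ℚ) → IsChromaticPoly G c
    → (k : ℕ) → treeCoeff L k ≡ rhs n c k
theorem3p2 n 1≤n G L expansion c chromatic k = begin
  treeCoeff L k
    ≡⟨ treeCoeff≡weightedTransforms k ⟩
  weightedTransforms k
    ≡⟨ weightedTransforms≡transformCoeff k ⟩
  transformCoeff n c k
    ≡⟨ transformCoeff≡rhs n c k (coeff-chromatic-0 1≤n G c chromatic) coeff-chromatic-above ⟩
  rhs n c k
    ∎
  where
  open PathExpansion G L expansion c chromatic
  open ≡.≡-Reasoning
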